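{- Let $r\in\mathbb{N}$ and let $\Gamma$ be a graph on $[n]$ that contains, as a spanning subgraph, an $r$-flower $A$ (with sets $V^{r+1}$, $V^i$, $R_i$, $V^i_j$ as in the definition). Then $A$ is $C_4$-saturated in $\Gamma$, and $$|E(A)|=|E(A[V^{r+1}])|+\frac{3}{2}\left(n-|V^{r+1}|-r\right)+3\left(|V^2|+\ldots+|V^{r+1}|\right).$$
   Context: For a graph $A$ and a vertex set $V$, $A[V]$ is the induced subgraph and $N_{A}(v)$ the neighbourhood of $v$. A graph $A$ on $[n]$ is an $r$-flower (with respect to $\Gamma$) if there exist sets $V^{r+1}$, and for each $i\in[r]$ sets $R_i=\{v^i_1,v^i_2,v^i_3\}$ and $V^i_1,V^i_2,V^i_3$, such that: (1) $V^1=[n]$ and for every $\ell\in[r]$, $V^{\ell}=V^{r+1}\sqcup\bigsqcup_{i=\ell}^{r}(V^i_1\sqcup V^i_2\sqcup V^i_3\sqcup R_i)$ (disjoint unions); (2) for every $i\in[r]$, $v^i_1,v^i_2,v^i_3$ are pairwise adjacent in $A$; (3) for every $i\in[r]$, $j\in\{1,2,3\}$, $N_{A[V^i]}(v^i_j)\setminus R_i=V^i_j$; (4) there are partitions $V^i_j=W^i_j\sqcup U^i_j\sqcup Y^i_j$ such that for all $i\in[r]$, $j\in\{1,2,3\}$: $E(A[W^i_j\sqcup V^{i+1}])\setminus E(A[V^{i+1}])$ is a perfect matching between $W^i_j$ and $V^{i+1}$; $E(A[W^i_j\sqcup U^i_j])$ is a perfect matching between $W^i_j$ and $U^i_j$;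 and $E(A[Y^i_j])$ is a perfect matching of $Y^i_j$; (5) $A[V^{r+1}]$ is an inclusion-maximal $C_4$-free spanning subgraph of $\Gamma[V^{r+1}]$; (6) $A$ has no edges other than those described in (2)–(5). A spanning subgraph $H$ of $\Gamma$ is $C_4$-saturated in $\Gamma$ if it contains no $4$-cycle as a subgraph but adding any edge of $\Gamma$ not in $H$ creates one. -}

module Defs where

open import Data.Nat using (ℕ; zero; suc; _+_; _*_; _∸_; _≤ᵇ_; _<ᵇ_)
open import Data.Bool using (Bool; true; false; _∧_; _∨_; not; if_then_else_)
open import Data.Fin using (Fin; toℕ; _≟_)
open import Data.List using (List; map; allFin)
open import Data.Nat.ListAction using (sum)
open import Data.Product using (Σ; _×_; ∃; ∃-syntax; _,_)
open import Data.Sum using (_⊎_)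
open import Data.Empty using (⊥)
open import Relation.Nullary using (¬_)
open import Relation.Nullary.Decidable using (⌊_⌋)
open import Relation.Binary.PropositionalEquality using (_≡_; _≢_)

Graph : ℕ → Set
Graph n = Fin n → Fin n → Bool

record IsSimple {n : ℕ} (G : Graph n) : Set where
  field
    symm    : ∀ x y → G x y ≡ G y x
    irrefl  : ∀ x → G x x ≡ false

VSet : ℕ → Set
VSet n = Fin n → Bool

_∈_ : {n : ℕ} → Fin n → VSet n → Set
x ∈ S = S x ≡ true

_∉_ : {n : ℕ} → Fin n → VSet n → Set
x ∉ S = S x ≡ false

Edge : {n : ℕ} → Graph n → Fin n → Fin n → Set
Edge G x y = G x y ≡ true

countL : {A : Set} → (A → Bool) → List A → ℕ
countL p xs = sum (map (λ a → if p a then 1 else 0) xs)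

card : {n : ℕ} → VSet n → ℕ
card {n} S = countL S (allFin n)

-- induced subgraph G[S] (viewed as a graph on [n] with no edges leaving S)
induced : {n : ℕ} → Graph n → VSet n → Graph n
induced G S x y = S x ∧ S y ∧ G x y

numEdges : {n : ℕ} → Graph n → ℕ
numEdges {n} G =
  sum (map (λ x → countL (λ y → (toℕ x <ᵇ toℕ y) ∧ G x y) (allFin n)) (allFin n))

_⊆G_ : {n : ℕ} → Graph n → Graph n → Set
H ⊆G G = ∀ x y → Edge H x y → Edge G x y

HasC4 : {n : ℕ} → Graph n → Set
HasC4 {n} G = Σ (Fin n) λ a → Σ (Fin n) λ b → Σ (Fin n) λ c → Σ (Fin n) λ d →
  (a ≢ b × a ≢ c × a ≢ d × b ≢ c × b ≢ d × c ≢ d) ×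
  (Edge G a b × Edge G b c × Edge G c d × Edge G d a)

C4Free : {n : ℕ} → Graph n → Set
C4Free G = ¬ HasC4 G

addEdge : {n : ℕ} → Graph n → Fin n → Fin n → Graph n
addEdge G x y u v =
  G u v ∨ ((⌊ u ≟ x ⌋ ∧ ⌊ v ≟ y ⌋) ∨ (⌊ u ≟ y ⌋ ∧ ⌊ v ≟ x ⌋))

C4Saturated : {n : ℕ} → Graph n → Graph n → Set
C4Saturated Γ H =
  H ⊆G Γ × C4Free H ×
  (∀ x y → Edge Γ x y → ¬ Edge H x y → HasC4 (addEdge H x y))

MaximalC4FreeSub : {n : ℕ} → Graph n → Graph n → Set
MaximalC4FreeSub {n} G H =
  H ⊆G G × C4Free H ×
  (∀ (K : Graph n) → IsSimple K → H ⊆G K → K ⊆G G → C4Free K →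
     ∀ x y → K x y ≡ H x y)

ExactlyOne : {n : ℕ} → (Fin n → Set) → Set
ExactlyOne {n} P = Σ (Fin n) λ y → P y × (∀ z → P z → z ≡ y)

PMBetween : {n : ℕ} → (Fin n → Fin n → Set) → VSet n → VSet n → Set
PMBetween E S T =
  (∀ x y → E x y → (x ∈ S × y ∈ T) ⊎ (x ∈ T × y ∈ S)) ×
  (∀ x → x ∈ S → ExactlyOne (λ y → E x y)) ×
  (∀ y → y ∈ T → ExactlyOne (λ x → E x y))

PMOf : {n : ℕ} → (Fin n → Fin n → Set) → VSet n → Set
PMOf E S =
  (∀ x y → E x y → x ∈ S × y ∈ S) ×
  (∀ x → x ∈ S → ExactlyOne (λ y → E x y))

EdgesOf : {n : ℕ} → Graph n → VSet n → Fin n → Fin n → Set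
EdgesOf G S x y = Edge (induced G S) x y

EdgesDiff : {n : ℕ} → Graph n → VSet n → VSet n → Fin n → Fin n → Set
EdgesDiff G S T x y = Edge (induced G S) x y × ¬ Edge (induced G T) x y

_∪_ : {n : ℕ} → VSet n → VSet n → VSet n
(S ∪ T) x = S x ∨ T x

-- Paper index i ∈ [r] is represented by i : Fin r (paper i = toℕ i + 1),
-- j ∈ {1,2,3} by j : Fin 3.  The disjoint decomposition of condition (1)
-- (together with the partitions V^i_j = W^i_j ⊔ U^i_j ⊔ Y^i_j of (4)) is
-- encoded by a labelling of every vertex with the unique part it lies in.

data Label (r : ℕ) : Set where
  top  : Label r                       -- V^{r+1}
  root : Fin r → Fin 3 → Label r       -- v^i_j  (R_i = {v^i_1,v^i_2,v^i_3})
  inW  : Fin r → Fin 3 → Label r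
  inU  : Fin r → Fin 3 → Label r
  inY  : Fin r → Fin 3 → Label r

_==_ : {m : ℕ} → Fin m → Fin m → Bool
a == b = ⌊ a ≟ b ⌋

isTop : {r : ℕ} → Label r → Bool
isTop top = true
isTop _   = false

isRoot : {r : ℕ} → Fin r → Label r → Bool
isRoot i (root i' _) = i == i'
isRoot i _ = false

isW isU isY : {r : ℕ} → Fin r → Fin 3 → Label r → Bool
isW i j (inW i' j') = (i == i') ∧ (j == j')
isW i j _ = false
isU i j (inU i' j') = (i == i') ∧ (j == j')
isU i j _ = false
isY i j (inY i' j') = (i == i') ∧ (j == j')
isY i j _ = false

inLevel : {r : ℕ} → ℕ → Label r → Bool
inLevel ℓ top = true
inLevel ℓ (root i _) = ℓ ≤ᵇ suc (toℕ i)
inLevel ℓ (inW i _)  = ℓ ≤ᵇ suc (toℕ i)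
inLevel ℓ (inU i _)  = ℓ ≤ᵇ suc (toℕ i)
inLevel ℓ (inY i _)  = ℓ ≤ᵇ suc (toℕ i)

module FlowerSets {n r : ℕ} (lab : Fin n → Label r) where

  Vtop : VSet n
  Vtop x = isTop (lab x)

  R : Fin r → VSet n
  R i x = isRoot i (lab x)

  W U Y : Fin r → Fin 3 → VSet n
  W i j x = isW i j (lab x)
  U i j x = isU i j (lab x)
  Y i j x = isY i j (lab x)

  Vij : Fin r → Fin 3 → VSet n
  Vij i j = W i j ∪ (U i j ∪ Y i j)

  -- V^ℓ = V^{r+1} ⊔ ⨆_{i ≥ ℓ} (V^i_1 ⊔ V^i_2 ⊔ V^i_3 ⊔ R_i), ℓ ∈ {1,…,r+1}
  Vlev : ℕ → VSet n
  Vlev ℓ x = inLevel ℓ (lab x)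

  -- V^i and V^{i+1} for i : Fin r (paper index toℕ i + 1)
  Vi : Fin r → VSet n
  Vi i = Vlev (suc (toℕ i))

  Vi+1 : Fin r → VSet n
  Vi+1 i = Vlev (suc (suc (toℕ i)))

  Allowed : Graph n → (Fin r → Fin 3 → Fin n) → Fin n → Fin n → Set
  Allowed A v x y =
    (Σ (Fin r) λ i → Σ (Fin 3) λ j → Σ (Fin 3) λ k →
        x ≡ v i j × y ≡ v i k × j ≢ k)
    ⊎ (Σ (Fin r) λ i → Σ (Fin 3) λ j →
        (x ≡ v i j × y ∈ Vij i j) ⊎ (y ≡ v i j × x ∈ Vij i j))
    ⊎ (Σ (Fin r) λ i → Σ (Fin 3) λ j →
        EdgesDiff A (W i j ∪ Vi+1 i) (Vi+1 i) x y
        ⊎ EdgesOf A (W i j ∪ U i j) x y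
        ⊎ EdgesOf A (Y i j) x y)
    ⊎ EdgesOf A Vtop x y

record Flower {n : ℕ} (Γ A : Graph n) (r : ℕ) : Set where
  field
    lab : Fin n → Label r
    v   : Fin r → Fin 3 → Fin n

  open FlowerSets lab public

  field
    v-lab   : ∀ i j → lab (v i j) ≡ root i j
    v-uniq  : ∀ x i j → lab x ≡ root i j → x ≡ v i j
    cond2   : ∀ i j k → j ≢ k → Edge A (v i j) (v i k)
    cond3   : ∀ i j x → x ∉ R i →
                (Edge (induced A (Vi i)) (v i j) x → x ∈ Vij i j) ×
                (x ∈ Vij i j → Edge (induced A (Vi i)) (v i j) x)
    cond4W  : ∀ i j → PMBetween (EdgesDiff A (W i j ∪ Vi+1 i) (Vi+1 i)) (W i j) (Vi+1 i)
    cond4U  : ∀ i j → PMBetween (EdgesOf A (W i j ∪ U i j)) (W i j) (U i j)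
    cond4Y  : ∀ i j → PMOf (EdgesOf A (Y i j)) (Y i j)
    cond5   : MaximalC4FreeSub (induced Γ Vtop) (induced A Vtop)
    cond6   : ∀ x y → Edge A x y → Allowed A v x y

-- Σ_{ℓ=2}^{r+1} |V^ℓ|
sumLevels : {n r : ℕ} {Γ A : Graph n} → Flower Γ A r → ℕ
sumLevels {r = r} F = sum (map (λ i → card (Flower.Vi+1 F i)) (allFin r))

-- Give every label a level: toℕ i for the parts of the i-th layer and r for V^{r+1}. Apart
-- from A[V^{r+1}], the edges of a flower join two vertices of the same level (the triangle
-- R_i, the stars at its roots, the matchings W–U and Y–Y) or go down from a vertex of V^{i+1}
-- to its partner in W^i_j.
--
-- Counting: every edge outside V^{r+1} hands the weight 2 to its endpoints, all of it to the
-- higher one, or split according to the kinds of two endpoints of equal level. A vertex of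
-- level ℓ collects 2 from each of its 3ℓ partners below and 3 from its own level (2 if it is
-- a root). Summing over the vertices, and using Σ_x level x = |V^2| + … + |V^{r+1}|, gives
-- 2|E(A)| − 2|E(A[V^{r+1}])| = 3(n − |V^{r+1}|) − 3r + 6(|V^2| + … + |V^{r+1}|).
--
-- No 4-cycle: start the cycle at a vertex of least level. Its cycle neighbours are roots or
-- petal vertices of its own layer, or the partner above a W-vertex; in each combination the
-- uniqueness of roots and of matching partners forces two vertices of the cycle to coincide.
-- If the least level is r, the cycle lies in A[V^{r+1}], which is C4-free by (5).
--
-- Saturation: a non-edge xy of Γ with an endpoint outside V^{r+1} is closed to a 4-cycle by a
-- path x–p–q–y through a root, a matching partner or a W-vertex of the lower endpoint's
-- layer; inside V^{r+1} this is the maximality in (5).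

module Submission where

open import Defs
open import Data.Bool using (Bool; true; false; T; not; _∧_; _∨_; if_then_else_)
open import Data.Bool.Properties
  using (T-≡; ∧-conicalˡ; ∧-conicalʳ; ∧-assoc; ∧-comm; ∧-zeroʳ; ∨-comm) renaming (_≟_ to _≟ᵇ_)
open import Data.Empty using (⊥; ⊥-elim)
open import Data.Fin using (Fin; toℕ; zero; suc)
open import Data.Fin.Properties using (suc-injective; toℕ-injective; toℕ<n; any?) renaming (_≟_ to _≟ᶠ_)
import Data.List as List
open import Data.List using (allFin)
open import Data.List.Properties using (map-tabulate)
open import Data.Nat using (ℕ; zero; suc; _+_; _*_; _∸_; _≤_; _<_; s≤s; _<ᵇ_; _<?_)
open import Data.Nat.ListAction using () renaming (sum to listSum)
open import Data.Nat.Properties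
  using ( +-*-semiring; +-identityʳ; +-comm; +-assoc; *-identityʳ; *-zeroʳ; *-comm; *-assoc; *-cancelˡ-≡; *-distribˡ-∸
        ; m+n∸m≡n; m+n∸n≡m; ≤-refl; ≤-trans; ≤-total; ≤-antisym; <⇒≤; <-irrefl; <-asym; <-cmp
        ; <⇒≢; <⇒≯; <⇒≱; ≮⇒≥; <ᵇ⇒<; <⇒<ᵇ)
open import Algebra.Properties.Semiring.Sum +-*-semiring
  using (sum-syntax; sum-cong-≗; sum-replicate-zero; ∑-distrib-+; ∑-comm; *-distribˡ-sum)
open import Data.Product using (Σ; _×_; _,_; proj₁; proj₂)
open import Data.Sum using (_⊎_; inj₁; inj₂)
open import Function using (_∘_; Equivalence)
open import Relation.Binary.Definitions using (tri<; tri≈; tri>)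
open import Relation.Binary.PropositionalEquality
open import Relation.Nullary using (¬_; Dec; yes; no)
open import Relation.Nullary.Decidable using (_×-dec_; ¬?)

𝟙 : Bool → ℕ
𝟙 b = if b then 1 else 0

𝟙-false : ∀ {b} → (b ≡ true → ⊥) → 𝟙 b ≡ 0
𝟙-false {true}  b≢true = ⊥-elim (b≢true refl)
𝟙-false {false} _      = refl

𝟙-split : ∀ a b c → 𝟙 c ≡ 𝟙 (a ∧ b ∧ c) + 𝟙 (c ∧ not (a ∧ b))
𝟙-split true  true  true  = refl
𝟙-split true  true  false = refl
𝟙-split true  false true  = refl
𝟙-split true  false false = refl
𝟙-split false _     true  = refl
𝟙-split false _     false = refl

𝟙-complement : ∀ b → 𝟙 b + 𝟙 (not b) ≡ 1
𝟙-complement true  = refl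
𝟙-complement false = refl

∧-true⁺ : ∀ {a b} → a ≡ true → b ≡ true → a ∧ b ≡ true
∧-true⁺ refl refl = refl

∨-trueˡ⁺ : ∀ {a} b → a ≡ true → a ∨ b ≡ true
∨-trueˡ⁺ b refl = refl

∨-trueʳ⁺ : ∀ a {b} → b ≡ true → a ∨ b ≡ true
∨-trueʳ⁺ true  _ = refl
∨-trueʳ⁺ false b = b

∨-true⁻ : ∀ a {b} → a ∨ b ≡ true → a ≡ true ⊎ b ≡ true
∨-true⁻ true  _ = inj₁ refl
∨-true⁻ false b = inj₂ b

true≢false : true ≢ false
true≢false ()

≢true⇒≡false : ∀ {b} → ¬ (b ≡ true) → b ≡ false
≢true⇒≡false {true}  b≢true = ⊥-elim (b≢true refl)
≢true⇒≡false {false} _      = refl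

==-refl : ∀ {m} (a : Fin m) → (a == a) ≡ true
==-refl a with a ≟ᶠ a
... | yes _   = refl
... | no a≢a = ⊥-elim (a≢a refl)

==-sound : ∀ {m} {a b : Fin m} → (a == b) ≡ true → a ≡ b
==-sound {a = a} {b} a==b with a ≟ᶠ b
... | yes a≡b = a≡b

T⇒≡true : ∀ {b} → T b → b ≡ true
T⇒≡true = Equivalence.to T-≡

≡true⇒T : ∀ {b} → b ≡ true → T b
≡true⇒T = Equivalence.from T-≡

<⇒<ᵇ≡true : ∀ {m n} → m < n → (m <ᵇ n) ≡ true
<⇒<ᵇ≡true = T⇒≡true ∘ <⇒<ᵇ

<ᵇ≡true⇒< : ∀ {m n} → (m <ᵇ n) ≡ true → m < n
<ᵇ≡true⇒< {m} {n} = <ᵇ⇒< m n ∘ ≡true⇒T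

∑-tabulate : ∀ {m} (f : Fin m → ℕ) → listSum (List.tabulate f) ≡ ∑[ i < m ] f i
∑-tabulate {zero}  f = refl
∑-tabulate {suc m} f = cong (f zero +_) (∑-tabulate (f ∘ suc))

∑-allFin : ∀ {m} (f : Fin m → ℕ) → listSum (List.map f (allFin m)) ≡ ∑[ i < m ] f i
∑-allFin f = trans (cong listSum (map-tabulate (λ i → i) f)) (∑-tabulate f)

card≡∑ : ∀ {n} (S : VSet n) → card S ≡ ∑[ x < n ] 𝟙 (S x)
card≡∑ S = ∑-allFin (𝟙 ∘ S)

∑-zero : ∀ {m} (f : Fin m → ℕ) → (∀ i → f i ≡ 0) → ∑[ i < m ] f i ≡ 0
∑-zero {m} f f≡0 = trans (sum-cong-≗ f≡0) (sum-replicate-zero m)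

∑-unique : ∀ {m} (f : Fin m → ℕ) w → (∀ i → i ≢ w → f i ≡ 0) → ∑[ i < m ] f i ≡ f w
∑-unique {suc m} f zero    f≡0 =
  trans (cong (f zero +_) (∑-zero (f ∘ suc) (λ i → f≡0 (suc i) λ ())))
        (+-identityʳ (f zero))
∑-unique {suc m} f (suc w) f≡0 =
  cong₂ _+_ (f≡0 zero λ ()) (∑-unique (f ∘ suc) w (λ i i≢w → f≡0 (suc i) (i≢w ∘ suc-injective)))

∑-𝟙-unique : ∀ {m} (p : Fin m → Bool) w → p w ≡ true → (∀ i → p i ≡ true → i ≡ w) →
  ∑[ i < m ] 𝟙 (p i) ≡ 1
∑-𝟙-unique p w pw unique =
  trans (∑-unique (𝟙 ∘ p) w (λ i i≢w → 𝟙-false (i≢w ∘ unique i))) (cong 𝟙 pw)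

∑-point : ∀ {m} (w : Fin m) → ∑[ i < m ] 𝟙 (i == w) ≡ 1
∑-point w = ∑-𝟙-unique _ w (==-refl w) λ _ → ==-sound

∑-const : ∀ m c → ∑[ i < m ] c ≡ m * c
∑-const zero    c = refl
∑-const (suc m) c = cong (c +_) (∑-const m c)

∑-𝟙-<ᵇ : ∀ {r} m → m ≤ r → ∑[ i < r ] 𝟙 (toℕ i <ᵇ m) ≡ m
∑-𝟙-<ᵇ {r}     zero    _         = ∑-zero {r} (λ i → 𝟙 (toℕ i <ᵇ 0)) (λ _ → refl)
∑-𝟙-<ᵇ {suc r} (suc m) (s≤s m≤r) = cong suc (∑-𝟙-<ᵇ m m≤r)

∑∑-transpose-+ : ∀ {m} (f : Fin m → Fin m → ℕ) →
  ∑[ x < m ] ∑[ y < m ] (f x y + f y x) ≡ 2 * ∑[ x < m ] ∑[ y < m ] f x y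
∑∑-transpose-+ {m} f = begin
  ∑[ x < m ] ∑[ y < m ] (f x y + f y x)
    ≡⟨ sum-cong-≗ (λ x → ∑-distrib-+ (f x) (λ y → f y x)) ⟩
  ∑[ x < m ] (∑[ y < m ] f x y + ∑[ y < m ] f y x)
    ≡⟨ ∑-distrib-+ (λ x → ∑[ y < m ] f x y) _ ⟩
  N + ∑[ x < m ] ∑[ y < m ] f y x
    ≡⟨ cong (N +_) (∑-comm (λ x y → f y x)) ⟩
  N + N
    ≡⟨ cong (N +_) (+-identityʳ N) ⟨
  2 * N                                                 ∎
  where
  open ≡-Reasoning
  N = ∑[ x < m ] ∑[ y < m ] f x y

∑∑-symmetrise : ∀ {m} (f g : Fin m → Fin m → ℕ) → (∀ x y → f x y + f y x ≡ 2 * g x y) →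
  ∑[ x < m ] ∑[ y < m ] g x y ≡ ∑[ x < m ] ∑[ y < m ] f x y
∑∑-symmetrise {m} f g f+fᵀ≡2g =
  *-cancelˡ-≡ (∑[ x < m ] ∑[ y < m ] g x y) (∑[ x < m ] ∑[ y < m ] f x y) 2 (begin
  2 * ∑[ x < m ] ∑[ y < m ] g x y          ≡⟨ *-distribˡ-sum {m} 2 (λ x → ∑[ y < m ] g x y) ⟩
  ∑[ x < m ] (2 * ∑[ y < m ] g x y)        ≡⟨ sum-cong-≗ (λ x → *-distribˡ-sum 2 (g x)) ⟩
  ∑[ x < m ] ∑[ y < m ] (2 * g x y)        ≡⟨ sum-cong-≗ (λ x → sum-cong-≗ (λ y → f+fᵀ≡2g x y)) ⟨
  ∑[ x < m ] ∑[ y < m ] (f x y + f y x)    ≡⟨ ∑∑-transpose-+ f ⟩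
  2 * ∑[ x < m ] ∑[ y < m ] f x y          ∎)
  where open ≡-Reasoning

handshake : ∀ {n} (G : Graph n) → IsSimple G →
  2 * numEdges G ≡ ∑[ x < n ] ∑[ y < n ] 𝟙 (G x y)
handshake {n} G simple = begin
  2 * numEdges G
    ≡⟨ cong (2 *_) numEdges≡∑ ⟩
  2 * ∑[ x < n ] ∑[ y < n ] forward x y
    ≡⟨ ∑∑-transpose-+ forward ⟨
  ∑[ x < n ] ∑[ y < n ] (forward x y + forward y x)
    ≡⟨ sum-cong-≗ (λ x → sum-cong-≗ (λ y → split x y)) ⟨
  ∑[ x < n ] ∑[ y < n ] 𝟙 (G x y)                     ∎
  where
  open ≡-Reasoning
  open IsSimple simple
  forward : Fin n → Fin n → ℕ
  forward x y = 𝟙 ((toℕ x <ᵇ toℕ y) ∧ G x y)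
  numEdges≡∑ : numEdges G ≡ ∑[ x < n ] ∑[ y < n ] forward x y
  numEdges≡∑ = trans (∑-allFin (λ x → countL (λ y → (toℕ x <ᵇ toℕ y) ∧ G x y) (allFin n)))
               (sum-cong-≗ (λ x → ∑-allFin (forward x)))
  split : ∀ x y → 𝟙 (G x y) ≡ forward x y + forward y x
  split x y with toℕ x <ᵇ toℕ y in x<y | toℕ y <ᵇ toℕ x in y<x
  ... | true  | true  = ⊥-elim (<-asym (<ᵇ≡true⇒< {toℕ x} x<y) (<ᵇ≡true⇒< {toℕ y} y<x))
  ... | true  | false = sym (+-identityʳ _)
  ... | false | true  = cong 𝟙 (symm x y)
  ... | false | false = trans (cong (𝟙 ∘ G x) (sym x≡y)) (cong 𝟙 (irrefl x))
    where
    ≮ : ∀ {a b} → (a <ᵇ b) ≡ false → b ≤ a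
    ≮ {a} {b} a≮b = ≮⇒≥ (λ a<b → subst T a≮b (<⇒<ᵇ {a} {b} a<b))
    x≡y : x ≡ y
    x≡y = toℕ-injective (≤-antisym (≮ y<x) (≮ x<y))

module _ {n : ℕ} where

  induced-edge⁻ : ∀ (G : Graph n) (S : VSet n) {x y} → Edge (induced G S) x y →
    x ∈ S × y ∈ S × Edge G x y
  induced-edge⁻ G S {x} {y} e =
    ∧-conicalˡ (S x) _ e , ∧-conicalˡ (S y) _ (∧-conicalʳ (S x) _ e) , ∧-conicalʳ (S y) _ (∧-conicalʳ (S x) _ e)

  induced-edge⁺ : ∀ (G : Graph n) (S : VSet n) {x y} → x ∈ S → y ∈ S → Edge G x y →
    Edge (induced G S) x y
  induced-edge⁺ G S x∈S y∈S e = ∧-true⁺ x∈S (∧-true⁺ y∈S e)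

  induced-simple : ∀ {G : Graph n} (S : VSet n) → IsSimple G → IsSimple (induced G S)
  induced-simple {G} S simple = record { symm = symm′ ; irrefl = irrefl′ }
    where
    open IsSimple simple
    symm′ : ∀ x y → induced G S x y ≡ induced G S y x
    symm′ x y rewrite symm x y =
      trans (sym (∧-assoc (S x) (S y) (G y x)))
            (trans (cong (_∧ G y x) (∧-comm (S x) (S y))) (∧-assoc (S y) (S x) (G y x)))
    irrefl′ : ∀ x → induced G S x x ≡ false
    irrefl′ x rewrite irrefl x = trans (cong (S x ∧_) (∧-zeroʳ (S x))) (∧-zeroʳ (S x))

  edge⇒≢ : ∀ {G : Graph n} {x y} → IsSimple G → Edge G x y → x ≢ y
  edge⇒≢ {x = x} simple xy refl = true≢false (trans (sym xy) (IsSimple.irrefl simple x))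

  HasC4-mono : ∀ {G G′ : Graph n} → G ⊆G G′ → HasC4 G → HasC4 G′
  HasC4-mono G⊆G′ (a , b , c , d , distinct , (ab , bc , cd , da)) =
    a , b , c , d , distinct , (G⊆G′ a b ab , G⊆G′ b c bc , G⊆G′ c d cd , G⊆G′ d a da)

  HasC4? : (G : Graph n) → Dec (HasC4 G)
  HasC4? G = any? λ a → any? λ b → any? λ c → any? λ d →
    (¬? (a ≟ᶠ b) ×-dec ¬? (a ≟ᶠ c) ×-dec ¬? (a ≟ᶠ d) ×-dec
     ¬? (b ≟ᶠ c) ×-dec ¬? (b ≟ᶠ d) ×-dec ¬? (c ≟ᶠ d))
    ×-dec ((G a b ≟ᵇ true) ×-dec (G b c ≟ᵇ true) ×-dec (G c d ≟ᵇ true) ×-dec (G d a ≟ᵇ true))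

  addEdge-⊇ : ∀ {G : Graph n} {x y} → G ⊆G addEdge G x y
  addEdge-⊇ {G} u v = ∨-trueˡ⁺ _

  addEdge-xy : ∀ (G : Graph n) x y → Edge (addEdge G x y) x y
  addEdge-xy G x y = ∨-trueʳ⁺ (G x y) (∨-trueˡ⁺ _ (∧-true⁺ (==-refl x) (==-refl y)))

  addEdge-yx : ∀ (G : Graph n) x y → Edge (addEdge G x y) y x
  addEdge-yx G x y = ∨-trueʳ⁺ (G y x) (∨-trueʳ⁺ (y == x ∧ x == y) (∧-true⁺ (==-refl y) (==-refl x)))

  addEdge-mono : ∀ {G G′ : Graph n} {x y} → G ⊆G G′ → addEdge G x y ⊆G addEdge G′ x y
  addEdge-mono {G} {G′} G⊆G′ u v e with ∨-true⁻ (G u v) e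
  ... | inj₁ uv  = ∨-trueˡ⁺ _ (G⊆G′ u v uv)
  ... | inj₂ new = ∨-trueʳ⁺ (G′ u v) new

  addEdge-⊆ : ∀ {G G′ : Graph n} {x y} → G ⊆G G′ → Edge G′ x y → Edge G′ y x → addEdge G x y ⊆G G′
  addEdge-⊆ {G} {G′} {x} {y} G⊆G′ xy yx u v e with ∨-true⁻ (G u v) e
  ... | inj₁ uv = G⊆G′ u v uv
  ... | inj₂ new with ∨-true⁻ (u == x ∧ v == y) new
  ... | inj₁ u=x,v=y
    rewrite ==-sound {a = u} (∧-conicalˡ _ _ u=x,v=y) | ==-sound {a = v} (∧-conicalʳ (u == x) _ u=x,v=y) = xy
  ... | inj₂ u=y,v=x
    rewrite ==-sound {a = u} (∧-conicalˡ _ _ u=y,v=x) | ==-sound {a = v} (∧-conicalʳ (u == y) _ u=y,v=x) = yx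

  addEdge-simple : ∀ {G : Graph n} {x y} → IsSimple G → x ≢ y → IsSimple (addEdge G x y)
  addEdge-simple {G} {x} {y} simple x≢y = record { symm = symm′ ; irrefl = irrefl′ }
    where
    open IsSimple simple
    symm′ : ∀ u v → addEdge G x y u v ≡ addEdge G x y v u
    symm′ u v = cong₂ _∨_ (symm u v)
      (trans (∨-comm (u == x ∧ v == y) _) (cong₂ _∨_ (∧-comm (u == y) _) (∧-comm (u == x) _)))
    not-both : ∀ {a b} u → a ≢ b → (u == a ∧ u == b) ≡ false
    not-both {a} {b} u a≢b with u ≟ᶠ a
    ... | no _     = refl
    ... | yes refl with u ≟ᶠ b
    ... | yes u≡b = ⊥-elim (a≢b u≡b)
    ... | no _    = refl
    irrefl′ : ∀ u → addEdge G x y u u ≡ false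
    irrefl′ u rewrite irrefl u | not-both u x≢y | not-both u (x≢y ∘ sym) = refl

  Path3 : Graph n → Fin n → Fin n → Set
  Path3 G x y = Σ (Fin n) λ p → Σ (Fin n) λ q → Edge G x p × Edge G p q × Edge G q y

  path3⇒C4 : ∀ {G : Graph n} {x y} → IsSimple G → ¬ Edge G x y → x ≢ y → Path3 G x y →
    HasC4 (addEdge G x y)
  path3⇒C4 {G} {x} {y} simple ¬xy x≢y (p , q , xp , pq , qy) =
    x , p , q , y , (edge⇒≢ simple xp , x≢q , x≢y , edge⇒≢ simple pq , p≢y , edge⇒≢ simple qy) ,
    (old x p xp , old p q pq , old q y qy , addEdge-yx G x y)
    where
    old : G ⊆G addEdge G x y
    old = addEdge-⊇ {G} {x} {y}
    x≢q : x ≢ q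
    x≢q refl = ¬xy qy
    p≢y : p ≢ y
    p≢y refl = ¬xy xp

  maximal⇒saturating : ∀ {G H : Graph n} {x y} → IsSimple G → IsSimple H → MaximalC4FreeSub G H →
    Edge G x y → ¬ Edge H x y → HasC4 (addEdge H x y)
  maximal⇒saturating {G} {H} {x} {y} simpleG simpleH (H⊆G , _ , maximal) xy ¬xy
    with HasC4? (addEdge H x y)
  ... | yes c4 = c4
  ... | no c4free = ⊥-elim (¬xy (trans (sym (maximal (addEdge H x y) simpleK (addEdge-⊇ {H} {x} {y}) K⊆G c4free x y))
                                      (addEdge-xy H x y)))
    where
    simpleK = addEdge-simple simpleH (edge⇒≢ simpleG xy)
    K⊆G = addEdge-⊆ H⊆G xy (trans (IsSimple.symm simpleG y x) xy)

  induced-⊆ : ∀ (G : Graph n) (S : VSet n) → induced G S ⊆G G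
  induced-⊆ G S x y e = proj₂ (proj₂ (induced-edge⁻ G S e))

other₁ other₂ : Fin 3 → Fin 3
other₁ zero             = suc zero
other₁ (suc zero)       = suc (suc zero)
other₁ (suc (suc zero)) = zero
other₂ zero             = suc (suc zero)
other₂ (suc zero)       = zero
other₂ (suc (suc zero)) = suc zero

other₁≢ : ∀ j → other₁ j ≢ j
other₁≢ zero             ()
other₁≢ (suc zero)       ()
other₁≢ (suc (suc zero)) ()

other₂≢ : ∀ j → other₂ j ≢ j
other₂≢ zero             ()
other₂≢ (suc zero)       ()
other₂≢ (suc (suc zero)) ()

other₁≢other₂ : ∀ j → other₁ j ≢ other₂ j
other₁≢other₂ zero             ()
other₁≢other₂ (suc zero)       ()
other₁≢other₂ (suc (suc zero)) ()

others : ∀ j k → j ≢ k → k ≡ other₁ j ⊎ k ≡ other₂ j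
others zero             zero             j≢k = ⊥-elim (j≢k refl)
others zero             (suc zero)       _   = inj₁ refl
others zero             (suc (suc zero)) _   = inj₂ refl
others (suc zero)       zero             _   = inj₂ refl
others (suc zero)       (suc zero)       j≢k = ⊥-elim (j≢k refl)
others (suc zero)       (suc (suc zero)) _   = inj₁ refl
others (suc (suc zero)) zero             _   = inj₁ refl
others (suc (suc zero)) (suc zero)       _   = inj₂ refl
others (suc (suc zero)) (suc (suc zero)) j≢k = ⊥-elim (j≢k refl)

no-fourth-in-Fin3 : ∀ {j k l m : Fin 3} → j ≢ k → j ≢ l → k ≢ l → j ≢ m → k ≢ m → l ≢ m → ⊥
no-fourth-in-Fin3 {j} {k} {l} {m} j≢k j≢l k≢l j≢m k≢m l≢m
  with others j k j≢k | others j l j≢l | others j m j≢m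
... | inj₁ refl | inj₁ refl | _         = k≢l refl
... | inj₂ refl | inj₂ refl | _         = k≢l refl
... | inj₁ refl | inj₂ refl | inj₁ refl = k≢m refl
... | inj₁ refl | inj₂ refl | inj₂ refl = l≢m refl
... | inj₂ refl | inj₁ refl | inj₁ refl = l≢m refl
... | inj₂ refl | inj₁ refl | inj₂ refl = k≢m refl

module FlowerStructure {n r : ℕ} {Γ A : Graph n} (simpleA : IsSimple A) (F : Flower Γ A r) where

  open Flower F public

  edge-sym : ∀ {x y} → Edge A x y → Edge A y x
  edge-sym {x} {y} xy = trans (IsSimple.symm simpleA y x) xy

  -- The i-th layer (paper index toℕ i + 1) has level toℕ i and V^{r+1} has level r, so that
  -- Above i describes membership in Vi+1 i = V^{toℕ i + 2}.
  level : Label r → ℕ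
  level top        = r
  level (root i _) = toℕ i
  level (inW i _)  = toℕ i
  level (inU i _)  = toℕ i
  level (inY i _)  = toℕ i

  level≤r : ∀ l → level l ≤ r
  level≤r top        = ≤-refl
  level≤r (root i _) = <⇒≤ (toℕ<n i)
  level≤r (inW i _)  = <⇒≤ (toℕ<n i)
  level≤r (inU i _)  = <⇒≤ (toℕ<n i)
  level≤r (inY i _)  = <⇒≤ (toℕ<n i)

  level≡r⇒top : ∀ l → level l ≡ r → l ≡ top
  level≡r⇒top top        _ = refl
  level≡r⇒top (root i _) e = ⊥-elim (<-irrefl e (toℕ<n i))
  level≡r⇒top (inW i _)  e = ⊥-elim (<-irrefl e (toℕ<n i))
  level≡r⇒top (inU i _)  e = ⊥-elim (<-irrefl e (toℕ<n i))
  level≡r⇒top (inY i _)  e = ⊥-elim (<-irrefl e (toℕ<n i))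

  Above : Fin r → Label r → Set
  Above i l = toℕ i < level l

  inLevel-level : ∀ (i : Fin r) l → inLevel (suc (suc (toℕ i))) l ≡ (toℕ i <ᵇ level l)
  inLevel-level i top        = sym (<⇒<ᵇ≡true (toℕ<n i))
  inLevel-level i (root _ _) = refl
  inLevel-level i (inW _ _)  = refl
  inLevel-level i (inU _ _)  = refl
  inLevel-level i (inY _ _)  = refl

  ∈Vi+1⇒Above : ∀ {i x} → x ∈ Vi+1 i → Above i (lab x)
  ∈Vi+1⇒Above {i} {x} x∈ = <ᵇ≡true⇒< (trans (sym (inLevel-level i (lab x))) x∈)

  Above⇒∈Vi+1 : ∀ {i x} → Above i (lab x) → x ∈ Vi+1 i
  Above⇒∈Vi+1 {i} {x} above = trans (inLevel-level i (lab x)) (<⇒<ᵇ≡true above)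

  isTop-sound : ∀ (l : Label r) → isTop l ≡ true → l ≡ top
  isTop-sound top _ = refl

  isW-sound : ∀ {i j} (l : Label r) → isW i j l ≡ true → l ≡ inW i j
  isW-sound (inW i′ j′) e = sym (cong₂ inW (==-sound (∧-conicalˡ _ _ e)) (==-sound (∧-conicalʳ _ _ e)))

  isU-sound : ∀ {i j} (l : Label r) → isU i j l ≡ true → l ≡ inU i j
  isU-sound (inU i′ j′) e = sym (cong₂ inU (==-sound (∧-conicalˡ _ _ e)) (==-sound (∧-conicalʳ _ _ e)))

  isY-sound : ∀ {i j} (l : Label r) → isY i j l ≡ true → l ≡ inY i j
  isY-sound (inY i′ j′) e = sym (cong₂ inY (==-sound (∧-conicalˡ _ _ e)) (==-sound (∧-conicalʳ _ _ e)))

  ∈Vtop⇒lab : ∀ {x} → x ∈ Vtop → lab x ≡ top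
  ∈Vtop⇒lab {x} = isTop-sound (lab x)

  ∈W⇒lab : ∀ {i j x} → x ∈ W i j → lab x ≡ inW i j
  ∈W⇒lab {x = x} = isW-sound (lab x)

  ∈U⇒lab : ∀ {i j x} → x ∈ U i j → lab x ≡ inU i j
  ∈U⇒lab {x = x} = isU-sound (lab x)

  ∈Y⇒lab : ∀ {i j x} → x ∈ Y i j → lab x ≡ inY i j
  ∈Y⇒lab {x = x} = isY-sound (lab x)

  lab⇒∈Vtop : ∀ {x} → lab x ≡ top → x ∈ Vtop
  lab⇒∈Vtop e = cong isTop e

  lab⇒∈W : ∀ {i j x} → lab x ≡ inW i j → x ∈ W i j
  lab⇒∈W {i} {j} e = trans (cong (isW i j) e) (∧-true⁺ (==-refl i) (==-refl j))

  lab⇒∈U : ∀ {i j x} → lab x ≡ inU i j → x ∈ U i j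
  lab⇒∈U {i} {j} e = trans (cong (isU i j) e) (∧-true⁺ (==-refl i) (==-refl j))

  lab⇒∈Y : ∀ {i j x} → lab x ≡ inY i j → x ∈ Y i j
  lab⇒∈Y {i} {j} e = trans (cong (isY i j) e) (∧-true⁺ (==-refl i) (==-refl j))

  root-injective : ∀ {i i′ : Fin r} {j j′} → root i j ≡ root i′ j′ → i ≡ i′ × j ≡ j′
  root-injective refl = refl , refl

  v-injective : ∀ {i j k} → v i j ≡ v i k → j ≡ k
  v-injective {i} {j} {k} e = proj₂ (root-injective (trans (sym (v-lab i j)) (trans (cong lab e) (v-lab i k))))

  data Petal (i : Fin r) (j : Fin 3) (l : Label r) : Set where
    W∈ : l ≡ inW i j → Petal i j l
    U∈ : l ≡ inU i j → Petal i j l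
    Y∈ : l ≡ inY i j → Petal i j l

  level-petal : ∀ {i j l} → Petal i j l → level l ≡ toℕ i
  level-petal (W∈ refl) = refl
  level-petal (U∈ refl) = refl
  level-petal (Y∈ refl) = refl

  petal-unique : ∀ {i j i′ j′ l} → Petal i j l → Petal i′ j′ l → i ≡ i′ × j ≡ j′
  petal-unique (W∈ refl) (W∈ refl) = refl , refl
  petal-unique (U∈ refl) (U∈ refl) = refl , refl
  petal-unique (Y∈ refl) (Y∈ refl) = refl , refl
  petal-unique (W∈ refl) (U∈ ())
  petal-unique (W∈ refl) (Y∈ ())
  petal-unique (U∈ refl) (W∈ ())
  petal-unique (U∈ refl) (Y∈ ())
  petal-unique (Y∈ refl) (W∈ ())
  petal-unique (Y∈ refl) (U∈ ())

  petal≢root : ∀ {i j l i′ k} → Petal i j l → l ≢ root i′ k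
  petal≢root (W∈ refl) ()
  petal≢root (U∈ refl) ()
  petal≢root (Y∈ refl) ()

  petal≢top : ∀ {i j l} → Petal i j l → l ≢ top
  petal≢top (W∈ refl) ()
  petal≢top (U∈ refl) ()
  petal≢top (Y∈ refl) ()

  ∈Vij⇒petal : ∀ {i j x} → x ∈ Vij i j → Petal i j (lab x)
  ∈Vij⇒petal {i} {j} {x} x∈ with ∨-true⁻ (W i j x) x∈
  ... | inj₁ x∈W = W∈ (∈W⇒lab x∈W)
  ... | inj₂ x∈UY with ∨-true⁻ (U i j x) x∈UY
  ... | inj₁ x∈U = U∈ (∈U⇒lab x∈U)
  ... | inj₂ x∈Y = Y∈ (∈Y⇒lab x∈Y)

  petal⇒∈Vij : ∀ {i j x} → Petal i j (lab x) → x ∈ Vij i j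
  petal⇒∈Vij {i} {j} {x} (W∈ e) = ∨-trueˡ⁺ _ (lab⇒∈W e)
  petal⇒∈Vij {i} {j} {x} (U∈ e) = ∨-trueʳ⁺ (W i j x) (∨-trueˡ⁺ _ (lab⇒∈U e))
  petal⇒∈Vij {i} {j} {x} (Y∈ e) = ∨-trueʳ⁺ (W i j x) (∨-trueʳ⁺ (U i j x) (lab⇒∈Y e))

  petal∉R : ∀ {i j i′ x} → Petal i j (lab x) → x ∉ R i′
  petal∉R {i′ = i′} (W∈ e) = cong (isRoot i′) e
  petal∉R {i′ = i′} (U∈ e) = cong (isRoot i′) e
  petal∉R {i′ = i′} (Y∈ e) = cong (isRoot i′) e

  data Mates (i : Fin r) (j : Fin 3) (l l′ : Label r) : Set where
    W-U : l ≡ inW i j → l′ ≡ inU i j → Mates i j l l′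
    U-W : l ≡ inU i j → l′ ≡ inW i j → Mates i j l l′
    Y-Y : l ≡ inY i j → l′ ≡ inY i j → Mates i j l l′

  mates-sym : ∀ {i j l l′} → Mates i j l l′ → Mates i j l′ l
  mates-sym (W-U e e′) = U-W e′ e
  mates-sym (U-W e e′) = W-U e′ e
  mates-sym (Y-Y e e′) = Y-Y e′ e

  mates⇒petal : ∀ {i j l l′} → Mates i j l l′ → Petal i j l′
  mates⇒petal (W-U _ e) = U∈ e
  mates⇒petal (U-W _ e) = W∈ e
  mates⇒petal (Y-Y _ e) = Y∈ e

  data EdgeType (x y : Fin n) : Set where
    root-root  : ∀ {i j k} → lab x ≡ root i j → lab y ≡ root i k → j ≢ k → EdgeType x y
    root-petal : ∀ {i j} → lab x ≡ root i j → Petal i j (lab y) → EdgeType x y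
    petal-root : ∀ {i j} → Petal i j (lab x) → lab y ≡ root i j → EdgeType x y
    mates      : ∀ {i j} → Mates i j (lab x) (lab y) → EdgeType x y
    W-down     : ∀ {i j} → lab x ≡ inW i j → Above i (lab y) → EdgeType x y
    down-W     : ∀ {i j} → Above i (lab x) → lab y ≡ inW i j → EdgeType x y
    top-top    : lab x ≡ top → lab y ≡ top → EdgeType x y

  edgeType : ∀ {x y} → Edge A x y → EdgeType x y
  edgeType {x} {y} xy with cond6 x y xy
  ... | inj₁ (i , j , k , refl , refl , j≢k) = root-root (v-lab i j) (v-lab i k) j≢k
  ... | inj₂ (inj₁ (i , j , inj₁ (refl , y∈))) = root-petal (v-lab i j) (∈Vij⇒petal y∈)
  ... | inj₂ (inj₁ (i , j , inj₂ (refl , x∈))) = petal-root (∈Vij⇒petal x∈) (v-lab i j)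
  ... | inj₂ (inj₂ (inj₂ xy∈top)) =
    top-top (∈Vtop⇒lab (proj₁ top-edge)) (∈Vtop⇒lab (proj₁ (proj₂ top-edge)))
    where top-edge = induced-edge⁻ A Vtop xy∈top
  ... | inj₂ (inj₂ (inj₁ (i , j , inj₁ xy∈W↓))) with proj₁ (cond4W i j) x y xy∈W↓
  ...   | inj₁ (x∈W , y∈V) = W-down (∈W⇒lab x∈W) (∈Vi+1⇒Above y∈V)
  ...   | inj₂ (x∈V , y∈W) = down-W (∈Vi+1⇒Above x∈V) (∈W⇒lab y∈W)
  edgeType {x} {y} xy | inj₂ (inj₂ (inj₁ (i , j , inj₂ (inj₁ xy∈WU)))) with proj₁ (cond4U i j) x y xy∈WU
  ...   | inj₁ (x∈W , y∈U) = mates (W-U (∈W⇒lab x∈W) (∈U⇒lab y∈U))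
  ...   | inj₂ (x∈U , y∈W) = mates (U-W (∈U⇒lab x∈U) (∈W⇒lab y∈W))
  edgeType {x} {y} xy | inj₂ (inj₂ (inj₁ (i , j , inj₂ (inj₂ xy∈Y)))) =
    mates (Y-Y (∈Y⇒lab (proj₁ (proj₁ (cond4Y i j) x y xy∈Y))) (∈Y⇒lab (proj₂ (proj₁ (cond4Y i j) x y xy∈Y))))

  label-clash : ∀ {x} {a b : Label r} → lab x ≡ a → lab x ≡ b → a ≢ b → ⊥
  label-clash e e′ a≢b = a≢b (trans (sym e) e′)

  petal→root : ∀ {i j x} → Petal i j (lab x) → Edge A x (v i j)
  petal→root {i} {j} {x} p =
    edge-sym (proj₂ (proj₂ (induced-edge⁻ A (Vi i) (proj₂ (cond3 i j x (petal∉R p)) (petal⇒∈Vij p)))))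

  root→root : ∀ {i j k x} → lab x ≡ root i j → j ≢ k → Edge A x (v i k)
  root→root {i} {j} {k} {x} e j≢k rewrite v-uniq x i j e = cond2 i j k j≢k

  root→petal : ∀ {i j x z} → lab x ≡ root i j → Petal i j (lab z) → Edge A x z
  root→petal {i} {j} {x} e p rewrite v-uniq x i j e = edge-sym (petal→root p)

  ¬Above-own : ∀ {i j} → ¬ Above i (inW i j)
  ¬Above-own {i} = <-irrefl {toℕ i} refl

  W-down-edge : ∀ {i j w y} → lab w ≡ inW i j → Above i (lab y) → Edge A w y →
    EdgesDiff A (W i j ∪ Vi+1 i) (Vi+1 i) w y
  W-down-edge {i} {j} {w} {y} w∈W y↑ wy =
    induced-edge⁺ A (W i j ∪ Vi+1 i) (∨-trueˡ⁺ _ (lab⇒∈W w∈W)) (∨-trueʳ⁺ (W i j y) (Above⇒∈Vi+1 y↑)) wy ,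
    λ wy↑ → ¬Above-own {i} {j} (subst (Above i) w∈W (∈Vi+1⇒Above (proj₁ (induced-edge⁻ A (Vi+1 i) wy↑))))

  W-partner : ∀ {i} j {y} → Above i (lab y) → Σ (Fin n) λ w → lab w ≡ inW i j × Edge A w y
  W-partner {i} j {y} y↑ with proj₂ (proj₂ (cond4W i j)) y (Above⇒∈Vi+1 y↑)
  ... | w , wy , _ with proj₁ (cond4W i j) w y wy
  ...   | inj₁ (w∈W , _) = w , ∈W⇒lab w∈W , proj₂ (proj₂ (induced-edge⁻ A (W i j ∪ Vi+1 i) (proj₁ wy)))
  ...   | inj₂ (_ , y∈W) = ⊥-elim (¬Above-own {i} {j} (subst (Above i) (∈W⇒lab y∈W) y↑))

  W-partner-unique : ∀ {i j y w w′} → Above i (lab y) → lab w ≡ inW i j → lab w′ ≡ inW i j →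
    Edge A w y → Edge A w′ y → w ≡ w′
  W-partner-unique {i} {j} {y} y↑ w∈W w′∈W wy w′y with proj₂ (proj₂ (cond4W i j)) y (Above⇒∈Vi+1 y↑)
  ... | _ , _ , unique = trans (unique _ (W-down-edge w∈W y↑ wy)) (sym (unique _ (W-down-edge w′∈W y↑ w′y)))

  down-partner-unique : ∀ {i j w y y′} → lab w ≡ inW i j → Above i (lab y) → Above i (lab y′) →
    Edge A w y → Edge A w y′ → y ≡ y′
  down-partner-unique {i} {j} {w} w∈W y↑ y′↑ wy wy′ with proj₁ (proj₂ (cond4W i j)) w (lab⇒∈W w∈W)
  ... | _ , _ , unique = trans (unique _ (W-down-edge w∈W y↑ wy)) (sym (unique _ (W-down-edge w∈W y′↑ wy′)))

  mate-exists : ∀ {i j x} → Petal i j (lab x) → Σ (Fin n) λ p → Mates i j (lab x) (lab p) × Edge A x p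
  mate-exists {i} {j} {x} (W∈ e) with proj₁ (proj₂ (cond4U i j)) x (lab⇒∈W e)
  ... | u , xu , _ with proj₁ (cond4U i j) x u xu
  ...   | inj₁ (_ , u∈U) = u , W-U e (∈U⇒lab u∈U) , proj₂ (proj₂ (induced-edge⁻ A (W i j ∪ U i j) xu))
  ...   | inj₂ (x∈U , _) = ⊥-elim (label-clash e (∈U⇒lab x∈U) λ ())
  mate-exists {i} {j} {x} (U∈ e) with proj₂ (proj₂ (cond4U i j)) x (lab⇒∈U e)
  ... | w , wx , _ with proj₁ (cond4U i j) w x wx
  ...   | inj₁ (w∈W , _) = w , U-W e (∈W⇒lab w∈W) , edge-sym (proj₂ (proj₂ (induced-edge⁻ A (W i j ∪ U i j) wx)))
  ...   | inj₂ (_ , x∈W) = ⊥-elim (label-clash e (∈W⇒lab x∈W) λ ())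
  mate-exists {i} {j} {x} (Y∈ e) with proj₂ (cond4Y i j) x (lab⇒∈Y e)
  ... | p , xp , _ =
    p , Y-Y e (∈Y⇒lab (proj₂ (proj₁ (cond4Y i j) x p xp))) , proj₂ (proj₂ (induced-edge⁻ A (Y i j) xp))

  mate-unique : ∀ {i j x p p′} → Mates i j (lab x) (lab p) → Mates i j (lab x) (lab p′) →
    Edge A x p → Edge A x p′ → p ≡ p′
  mate-unique {i} {j} {x} (W-U e ep) (W-U _ ep′) xp xp′ with proj₁ (proj₂ (cond4U i j)) x (lab⇒∈W e)
  ... | _ , _ , unique = trans (unique _ (edge ep xp)) (sym (unique _ (edge ep′ xp′)))
    where
    edge : ∀ {u} → lab u ≡ inU i j → Edge A x u → EdgesOf A (W i j ∪ U i j) x u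
    edge {u} u∈U xu =
      induced-edge⁺ A (W i j ∪ U i j) (∨-trueˡ⁺ _ (lab⇒∈W e)) (∨-trueʳ⁺ (W i j u) (lab⇒∈U u∈U)) xu
  mate-unique {i} {j} {x} (U-W e ep) (U-W _ ep′) xp xp′ with proj₂ (proj₂ (cond4U i j)) x (lab⇒∈U e)
  ... | _ , _ , unique = trans (unique _ (edge ep xp)) (sym (unique _ (edge ep′ xp′)))
    where
    edge : ∀ {w} → lab w ≡ inW i j → Edge A x w → EdgesOf A (W i j ∪ U i j) w x
    edge {w} w∈W xw =
      induced-edge⁺ A (W i j ∪ U i j) (∨-trueˡ⁺ _ (lab⇒∈W w∈W)) (∨-trueʳ⁺ (W i j x) (lab⇒∈U e)) (edge-sym xw)
  mate-unique {i} {j} {x} (Y-Y e ep) (Y-Y _ ep′) xp xp′ with proj₂ (cond4Y i j) x (lab⇒∈Y e)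
  ... | _ , _ , unique = trans (unique _ (edge ep xp)) (sym (unique _ (edge ep′ xp′)))
    where
    edge : ∀ {y} → lab y ≡ inY i j → Edge A x y → EdgesOf A (Y i j) x y
    edge y∈Y xy = induced-edge⁺ A (Y i j) (lab⇒∈Y e) (lab⇒∈Y y∈Y) xy
  mate-unique (W-U e _) (U-W e′ _) _ _ = ⊥-elim (label-clash e e′ λ ())
  mate-unique (W-U e _) (Y-Y e′ _) _ _ = ⊥-elim (label-clash e e′ λ ())
  mate-unique (U-W e _) (W-U e′ _) _ _ = ⊥-elim (label-clash e e′ λ ())
  mate-unique (U-W e _) (Y-Y e′ _) _ _ = ⊥-elim (label-clash e e′ λ ())
  mate-unique (Y-Y e _) (W-U e′ _) _ _ = ⊥-elim (label-clash e e′ λ ())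
  mate-unique (Y-Y e _) (U-W e′ _) _ _ = ⊥-elim (label-clash e e′ λ ())

module EdgeCount {n r : ℕ} {Γ A : Graph n} (simpleA : IsSimple A) (F : Flower Γ A r) where

  open FlowerStructure simpleA F

  data Kind : Set where
    topKind rootKind petalKind : Kind

  kind : Label r → Kind
  kind top        = topKind
  kind (root _ _) = rootKind
  kind (inW _ _)  = petalKind
  kind (inU _ _)  = petalKind
  kind (inY _ _)  = petalKind

  -- Chosen so that a petal vertex collects 3 from its own level and a root 2 (see base).
  tie : Kind → Kind → ℕ
  tie rootKind  rootKind  = 1
  tie rootKind  petalKind = 0
  tie petalKind rootKind  = 2
  tie petalKind petalKind = 1
  tie _         _         = 0

  tie-sum : ∀ p q → p ≢ topKind → q ≢ topKind → tie p q + tie q p ≡ 2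
  tie-sum topKind   _         p≢top _     = ⊥-elim (p≢top refl)
  tie-sum _         topKind   _     q≢top = ⊥-elim (q≢top refl)
  tie-sum rootKind  rootKind  _     _     = refl
  tie-sum rootKind  petalKind _     _     = refl
  tie-sum petalKind rootKind  _     _     = refl
  tie-sum petalKind petalKind _     _     = refl

  kind-top : ∀ l → kind l ≡ topKind → l ≡ top
  kind-top top _ = refl

  share : Label r → Label r → ℕ
  share a b = if level b <ᵇ level a then 2 else if level a <ᵇ level b then 0 else tie (kind a) (kind b)

  share-> : ∀ a b → level b < level a → share a b ≡ 2
  share-> a b b<a rewrite <⇒<ᵇ≡true b<a = refl

  share-< : ∀ a b → level a < level b → share a b ≡ 0
  share-< a b a<b rewrite ≢true⇒≡false (<⇒≯ a<b ∘ <ᵇ≡true⇒< {level b}) | <⇒<ᵇ≡true a<b = refl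

  share-≡ : ∀ a b → level a ≡ level b → share a b ≡ tie (kind a) (kind b)
  share-≡ a b a≡b rewrite a≡b | ≢true⇒≡false (<-irrefl refl ∘ <ᵇ≡true⇒< {level b} {level b}) = refl

  share-sum : ∀ a b → ¬ (a ≡ top × b ≡ top) → share a b + share b a ≡ 2
  share-sum a b not-top with <-cmp (level a) (level b)
  ... | tri< a<b _ _ = cong₂ _+_ (share-< a b a<b) (share-> b a a<b)
  ... | tri> _ _ b<a = cong₂ _+_ (share-> a b b<a) (share-< b a b<a)
  ... | tri≈ _ a≡b _ = trans (cong₂ _+_ (share-≡ a b a≡b) (share-≡ b a (sym a≡b)))
                             (tie-sum (kind a) (kind b) a≢top b≢top)
    where
    a≢top : kind a ≢ topKind
    a≢top k = not-top (a=top , level≡r⇒top b (trans (sym a≡b) (cong level a=top)))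
      where a=top = kind-top a k
    b≢top : kind b ≢ topKind
    b≢top k = not-top (level≡r⇒top a (trans a≡b (cong level b=top)) , b=top)
      where b=top = kind-top b k

  weight : Fin n → Fin n → ℕ
  weight x y = if A x y then share (lab x) (lab y) else 0

  weight-sum : ∀ x y → weight x y + weight y x ≡ 2 * 𝟙 (A x y ∧ not (Vtop x ∧ Vtop y))
  weight-sum x y with A x y in xy
  ... | false rewrite trans (IsSimple.symm simpleA y x) xy = refl
  ... | true rewrite trans (IsSimple.symm simpleA y x) xy with Vtop x in x↑ | Vtop y in y↑
  ...   | true  | true  rewrite ∈Vtop⇒lab x↑ | ∈Vtop⇒lab y↑ = cong₂ _+_ top-share top-share
    where top-share = share-≡ top top refl
  ...   | true  | false = share-sum (lab x) (lab y) λ (_ , y=top) → true≢false (trans (sym (lab⇒∈Vtop y=top)) y↑)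
  ...   | false | _     = share-sum (lab x) (lab y) λ (x=top , _) → true≢false (trans (sym (lab⇒∈Vtop x=top)) x↑)

  weight-absent : ∀ {x y} → A x y ≡ false → weight x y ≡ 0
  weight-absent {x} {y} ¬xy = cong (λ b → if b then share (lab x) (lab y) else 0) ¬xy

  weight-present : ∀ {x y} → Edge A x y → weight x y ≡ share (lab x) (lab y)
  weight-present {x} {y} xy = cong (λ b → if b then share (lab x) (lab y) else 0) xy

  downward : Fin n → Fin n → ℕ
  downward x y = ∑[ i < r ] (𝟙 (Vi+1 i x) * ∑[ j < 3 ] 𝟙 (A x y ∧ W i j y))

  downward-zero : ∀ {x y} → (∀ i j → Edge A x y → lab y ≢ inW i j) → downward x y ≡ 0
  downward-zero {x} {y} ¬W = ∑-zero _ λ i →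
    trans (cong (𝟙 (Vi+1 i x) *_) (∑-zero _ λ j → 𝟙-false λ t →
             ¬W i j (∧-conicalˡ (A x y) _ t) (∈W⇒lab (∧-conicalʳ (A x y) _ t))))
          (*-zeroʳ (𝟙 (Vi+1 i x)))

  downward-W : ∀ {x y i₀ j₀} → Edge A x y → lab y ≡ inW i₀ j₀ → downward x y ≡ 𝟙 (Vi+1 i₀ x)
  downward-W {x} {y} {i₀} {j₀} xy y∈W = begin
    downward x y
      ≡⟨ sum-cong-≗ (λ i → cong (λ b → 𝟙 (Vi+1 i x) * ∑[ j < 3 ] 𝟙 (b ∧ W i j y)) xy) ⟩
    ∑[ i < r ] (𝟙 (Vi+1 i x) * ∑[ j < 3 ] 𝟙 (W i j y))
      ≡⟨ ∑-unique _ i₀ other-layer ⟩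
    𝟙 (Vi+1 i₀ x) * ∑[ j < 3 ] 𝟙 (W i₀ j y)
      ≡⟨ cong (𝟙 (Vi+1 i₀ x) *_) (∑-𝟙-unique _ j₀ (lab⇒∈W y∈W) λ _ y∈ → proj₂ (index y∈)) ⟩
    𝟙 (Vi+1 i₀ x) * 1
      ≡⟨ *-identityʳ _ ⟩
    𝟙 (Vi+1 i₀ x)                                      ∎
    where
    open ≡-Reasoning
    index : ∀ {i j} → y ∈ W i j → i ≡ i₀ × j ≡ j₀
    index y∈ with trans (sym (∈W⇒lab y∈)) y∈W
    ... | refl = refl , refl
    other-layer : ∀ i → i ≢ i₀ → 𝟙 (Vi+1 i x) * ∑[ j < 3 ] 𝟙 (W i j y) ≡ 0
    other-layer i i≢i₀ =
      trans (cong (𝟙 (Vi+1 i x) *_)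
                  (∑-zero (λ j → 𝟙 (W i j y)) λ j → 𝟙-false (i≢i₀ ∘ proj₁ ∘ index {i} {j})))
            (*-zeroʳ (𝟙 (Vi+1 i x)))

  downward-level : ∀ {x y} → Edge A x y → ¬ (level (lab y) < level (lab x)) → downward x y ≡ 0
  downward-level {x} {y} xy ¬below = go (lab y) refl
    where
    go : ∀ l → lab y ≡ l → downward x y ≡ 0
    go (inW i j)  e = trans (downward-W xy e)
                            (𝟙-false (¬below ∘ subst (_< level (lab x)) (cong level (sym e)) ∘ ∈Vi+1⇒Above))
    go top        e = downward-zero λ _ _ _ e′ → label-clash e e′ λ ()
    go (root _ _) e = downward-zero λ _ _ _ e′ → label-clash e e′ λ ()
    go (inU _ _)  e = downward-zero λ _ _ _ e′ → label-clash e e′ λ ()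
    go (inY _ _)  e = downward-zero λ _ _ _ e′ → label-clash e e′ λ ()

  W-neighbours : ∀ {i} j {x} → x ∈ Vi+1 i → ∑[ y < n ] 𝟙 (A x y ∧ W i j y) ≡ 1
  W-neighbours {i} j {x} x↑ with W-partner j (∈Vi+1⇒Above x↑)
  ... | w , w∈W , wx = ∑-𝟙-unique _ w (∧-true⁺ (edge-sym wx) (lab⇒∈W w∈W)) λ z t →
    W-partner-unique (∈Vi+1⇒Above x↑) (∈W⇒lab (∧-conicalʳ (A x z) _ t)) w∈W
                     (edge-sym (∧-conicalˡ (A x z) _ t)) wx

  ∑-downward : ∀ x → ∑[ y < n ] downward x y ≡ 3 * level (lab x)
  ∑-downward x = begin
    ∑[ y < n ] ∑[ i < r ] (𝟙 (Vi+1 i x) * ∑[ j < 3 ] 𝟙 (A x y ∧ W i j y))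
      ≡⟨ ∑-comm (λ y i → 𝟙 (Vi+1 i x) * ∑[ j < 3 ] 𝟙 (A x y ∧ W i j y)) ⟩
    ∑[ i < r ] ∑[ y < n ] (𝟙 (Vi+1 i x) * ∑[ j < 3 ] 𝟙 (A x y ∧ W i j y))
      ≡⟨ sum-cong-≗ (λ i → *-distribˡ-sum {n} (𝟙 (Vi+1 i x)) (λ y → ∑[ j < 3 ] 𝟙 (A x y ∧ W i j y))) ⟨
    ∑[ i < r ] (𝟙 (Vi+1 i x) * ∑[ y < n ] ∑[ j < 3 ] 𝟙 (A x y ∧ W i j y))
      ≡⟨ sum-cong-≗ (λ i → cong (𝟙 (Vi+1 i x) *_) (∑-comm (λ y j → 𝟙 (A x y ∧ W i j y)))) ⟩
    ∑[ i < r ] (𝟙 (Vi+1 i x) * ∑[ j < 3 ] ∑[ y < n ] 𝟙 (A x y ∧ W i j y))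
      ≡⟨ sum-cong-≗ three-per-layer ⟩
    ∑[ i < r ] (3 * 𝟙 (toℕ i <ᵇ level (lab x)))
      ≡⟨ *-distribˡ-sum {r} 3 (λ i → 𝟙 (toℕ i <ᵇ level (lab x))) ⟨
    3 * ∑[ i < r ] 𝟙 (toℕ i <ᵇ level (lab x))
      ≡⟨ cong (3 *_) (∑-𝟙-<ᵇ _ (level≤r (lab x))) ⟩
    3 * level (lab x)                                                       ∎
    where
    open ≡-Reasoning
    three-per-layer : ∀ i →
      𝟙 (Vi+1 i x) * ∑[ j < 3 ] ∑[ y < n ] 𝟙 (A x y ∧ W i j y) ≡ 3 * 𝟙 (toℕ i <ᵇ level (lab x))
    three-per-layer i rewrite sym (inLevel-level i (lab x)) with Vi+1 i x in x↑
    ... | false = refl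
    ... | true  = trans (+-identityʳ _) (sum-cong-≗ λ j → W-neighbours j x↑)

  mateSet : Label r → VSet n
  mateSet (inW i j) = U i j
  mateSet (inU i j) = W i j
  mateSet (inY i j) = Y i j
  mateSet _         = λ _ → false

  mateSet-sound : ∀ {i j l y} → Petal i j l → y ∈ mateSet l → Mates i j l (lab y)
  mateSet-sound (W∈ refl) y∈ = W-U refl (∈U⇒lab y∈)
  mateSet-sound (U∈ refl) y∈ = U-W refl (∈W⇒lab y∈)
  mateSet-sound (Y∈ refl) y∈ = Y-Y refl (∈Y⇒lab y∈)

  mateSet-complete : ∀ {i j l y} → Mates i j l (lab y) → y ∈ mateSet l
  mateSet-complete (W-U refl e) = lab⇒∈U e
  mateSet-complete (U-W refl e) = lab⇒∈W e
  mateSet-complete (Y-Y refl e) = lab⇒∈Y e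

  sameLevel : Fin n → Label r → Fin n → ℕ
  sameLevel x top        y = 0
  sameLevel x (root i j) y = 𝟙 (y == v i (other₁ j)) + 𝟙 (y == v i (other₂ j))
  sameLevel x l@(inW i j) y = 2 * 𝟙 (y == v i j) + 𝟙 (A x y ∧ mateSet l y)
  sameLevel x l@(inU i j) y = 2 * 𝟙 (y == v i j) + 𝟙 (A x y ∧ mateSet l y)
  sameLevel x l@(inY i j) y = 2 * 𝟙 (y == v i j) + 𝟙 (A x y ∧ mateSet l y)

  sameLevel-petal : ∀ {i j l} x y → Petal i j l → sameLevel x l y ≡ 2 * 𝟙 (y == v i j) + 𝟙 (A x y ∧ mateSet l y)
  sameLevel-petal x y (W∈ refl) = refl
  sameLevel-petal x y (U∈ refl) = refl
  sameLevel-petal x y (Y∈ refl) = refl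

  base : Label r → ℕ
  base top        = 0
  base (root _ _) = 2
  base _          = 3

  ∑-mates : ∀ {i j x} → Petal i j (lab x) → ∑[ y < n ] 𝟙 (A x y ∧ mateSet (lab x) y) ≡ 1
  ∑-mates {x = x} p with mate-exists p
  ... | q , mates-q , xq = ∑-𝟙-unique _ q (∧-true⁺ xq (mateSet-complete mates-q)) λ z t →
    mate-unique (mateSet-sound p (∧-conicalʳ (A x z) _ t)) mates-q (∧-conicalˡ (A x z) _ t) xq

  ∑-sameLevel : ∀ x → ∑[ y < n ] sameLevel x (lab x) y ≡ base (lab x)
  ∑-sameLevel x = go (lab x) refl
    where
    petal : ∀ {i j} l → Petal i j l → lab x ≡ l → ∑[ y < n ] sameLevel x l y ≡ 3
    petal {i} {j} l p refl = begin
      ∑[ y < n ] sameLevel x l y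
        ≡⟨ sum-cong-≗ (λ y → sameLevel-petal x y p) ⟩
      ∑[ y < n ] (2 * 𝟙 (y == v i j) + 𝟙 (A x y ∧ mateSet l y))
        ≡⟨ ∑-distrib-+ (λ y → 2 * 𝟙 (y == v i j)) (λ y → 𝟙 (A x y ∧ mateSet l y)) ⟩
      ∑[ y < n ] (2 * 𝟙 (y == v i j)) + ∑[ y < n ] 𝟙 (A x y ∧ mateSet l y)
        ≡⟨ cong₂ _+_ (sym (*-distribˡ-sum 2 (λ y → 𝟙 (y == v i j)))) (∑-mates p) ⟩
      2 * ∑[ y < n ] 𝟙 (y == v i j) + 1
        ≡⟨ cong (λ k → 2 * k + 1) (∑-point (v i j)) ⟩
      3                                                                   ∎
      where open ≡-Reasoning
    go : ∀ l → lab x ≡ l → ∑[ y < n ] sameLevel x l y ≡ base l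
    go top        _ = ∑-zero {n} (λ _ → 0) λ _ → refl
    go (root i j) _ =
      trans (∑-distrib-+ (λ y → 𝟙 (y == v i (other₁ j))) (λ y → 𝟙 (y == v i (other₂ j))))
            (cong₂ _+_ (∑-point (v i (other₁ j))) (∑-point (v i (other₂ j))))
    go (inW i j)  e = petal _ (W∈ refl) e
    go (inU i j)  e = petal _ (U∈ refl) e
    go (inY i j)  e = petal _ (Y∈ refl) e

  kind-petal : ∀ {i j l} → Petal i j l → kind l ≡ petalKind
  kind-petal (W∈ refl) = refl
  kind-petal (U∈ refl) = refl
  kind-petal (Y∈ refl) = refl

  not-root : ∀ {i k y} → (lab y ≢ root i k) → 𝟙 (y == v i k) ≡ 0
  not-root {i} {k} y≢root = 𝟙-false λ t → y≢root (trans (cong lab (==-sound t)) (v-lab i k))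

  v-distinct : ∀ {i a b} → a ≢ b → 𝟙 (v i a == v i b) ≡ 0
  v-distinct a≢b = 𝟙-false (a≢b ∘ v-injective ∘ ==-sound)

  the-other-root : ∀ {i j k y} → lab y ≡ root i k → j ≢ k →
    𝟙 (y == v i (other₁ j)) + 𝟙 (y == v i (other₂ j)) ≡ 1
  the-other-root {i} {j} {k} {y} y-root j≢k rewrite v-uniq y i k y-root with others j k j≢k
  ... | inj₁ refl = cong₂ _+_ (cong 𝟙 (==-refl (v i k))) (v-distinct (other₁≢other₂ j))
  ... | inj₂ refl = cong₂ _+_ (v-distinct (other₁≢other₂ j ∘ sym)) (cong 𝟙 (==-refl (v i k)))

  sameLevel-absent : ∀ {x y} → A x y ≡ false → sameLevel x (lab x) y ≡ 0
  sameLevel-absent {x} {y} ¬xy = go (lab x) refl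
    where
    not-neighbour : ∀ {w} → Edge A x w → 𝟙 (y == w) ≡ 0
    not-neighbour xw = 𝟙-false λ t → true≢false (trans (sym (subst (Edge A x) (sym (==-sound t)) xw)) ¬xy)
    petal : ∀ {i j} l → Petal i j l → lab x ≡ l → sameLevel x l y ≡ 0
    petal {i} {j} l p e = trans (sameLevel-petal x y p)
      (cong₂ _+_ (cong (2 *_) (not-neighbour (petal→root (subst (Petal i j) (sym e) p))))
                 (cong (λ b → 𝟙 (b ∧ mateSet l y)) ¬xy))
    go : ∀ l → lab x ≡ l → sameLevel x l y ≡ 0
    go top        _ = refl
    go (root i j) e = cong₂ _+_ (not-neighbour (root→root e (other₁≢ j ∘ sym)))
                                (not-neighbour (root→root e (other₂≢ j ∘ sym)))
    go (inW i j)  e = petal _ (W∈ refl) e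
    go (inU i j)  e = petal _ (U∈ refl) e
    go (inY i j)  e = petal _ (Y∈ refl) e

  sameLevel-level : ∀ {x y} → level (lab y) ≢ level (lab x) → sameLevel x (lab x) y ≡ 0
  sameLevel-level {x} {y} y≠x = go (lab x) refl
    where
    away : ∀ {i k} → level (lab x) ≡ toℕ i → 𝟙 (y == v i k) ≡ 0
    away x-level = not-root λ e → y≠x (trans (cong level e) (sym x-level))
    petal : ∀ {i j} l → Petal i j l → lab x ≡ l → sameLevel x l y ≡ 0
    petal {i} {j} l p e = trans (sameLevel-petal x y p)
      (cong₂ _+_ (cong (2 *_) (away x-level))
                 (𝟙-false λ t → y≠x (trans (level-petal (mates⇒petal (mateSet-sound p (∧-conicalʳ (A x y) _ t))))
                                          (sym x-level))))
      where x-level = trans (cong level e) (level-petal p)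
    go : ∀ l → lab x ≡ l → sameLevel x l y ≡ 0
    go top        _ = refl
    go (root i j) e = cong₂ _+_ (away (cong level e)) (away (cong level e))
    go (inW i j)  e = petal _ (W∈ refl) e
    go (inU i j)  e = petal _ (U∈ refl) e
    go (inY i j)  e = petal _ (Y∈ refl) e

  split-as : ∀ {s d t a b c} → s ≡ a → d ≡ b → t ≡ c → a ≡ 2 * b + c → s ≡ 2 * d + t
  split-as refl refl refl a≡2b+c = a≡2b+c

  weight-split : ∀ x y → weight x y ≡ 2 * downward x y + sameLevel x (lab x) y
  weight-split x y = by-edge (A x y) refl
    where
    by-edge : ∀ b → A x y ≡ b → weight x y ≡ 2 * downward x y + sameLevel x (lab x) y
    by-edge false ¬xy = split-as (weight-absent ¬xy) (downward-zero λ _ _ xy _ → true≢false (trans (sym xy) ¬xy))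
                                 (sameLevel-absent ¬xy) refl
    by-edge true  xy  = trans (weight-present xy) (by-type (edgeType xy))
      where
      share-tie : ∀ {a b} → lab x ≡ a → lab y ≡ b → level a ≡ level b →
        share (lab x) (lab y) ≡ tie (kind a) (kind b)
      share-tie refl refl = share-≡ (lab x) (lab y)
      flat : ∀ {a b} → lab x ≡ a → lab y ≡ b → level a ≡ level b → downward x y ≡ 0
      flat refl refl a≡b = downward-level xy (<-irrefl (sym a≡b))
      at : ∀ {l} → lab x ≡ l → sameLevel x (lab x) y ≡ sameLevel x l y
      at = cong (λ l → sameLevel x l y)
      by-type : EdgeType x y → share (lab x) (lab y) ≡ 2 * downward x y + sameLevel x (lab x) y
      by-type (root-root ex ey j≢k) =
        split-as (share-tie ex ey refl) (flat ex ey refl) (trans (at ex) (the-other-root ey j≢k)) refl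
      by-type (root-petal ex p) =
        split-as (trans (share-tie ex refl (sym (level-petal p))) (cong (tie rootKind) (kind-petal p)))
                 (flat ex refl (sym (level-petal p)))
                 (trans (at ex) (cong₂ _+_ (not-root (petal≢root p)) (not-root (petal≢root p)))) refl
      by-type (petal-root p ey) =
        split-as (trans (share-tie refl ey (level-petal p)) (cong (λ k → tie k rootKind) (kind-petal p)))
                 (flat refl ey (level-petal p))
                 (trans (sameLevel-petal x y p)
                        (cong₂ _+_ (cong (λ t → 2 * 𝟙 t) (subst (λ z → (z == _) ≡ true) (sym (v-uniq y _ _ ey))
                                                                       (==-refl _)))
                                   (𝟙-false λ t → petal≢root (mates⇒petal (mateSet-sound p (∧-conicalʳ (A x y) _ t))) ey)))
                 refl
      by-type (mates m) =
        split-as (trans (share-tie refl refl (trans (level-petal px) (sym (level-petal py))))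
                        (cong₂ tie (kind-petal px) (kind-petal py)))
                 (flat refl refl (trans (level-petal px) (sym (level-petal py))))
                 (trans (sameLevel-petal x y px)
                        (cong₂ _+_ (cong (2 *_) (not-root (petal≢root py)))
                                   (cong 𝟙 (∧-true⁺ xy (mateSet-complete m)))))
                 refl
        where px = mates⇒petal (mates-sym m)
              py = mates⇒petal m
      by-type (W-down ex y↑) =
        split-as (share-< (lab x) (lab y) x<y) (downward-level xy (<⇒≯ x<y)) (sameLevel-level (<⇒≢ x<y ∘ sym)) refl
        where x<y = subst (_< level (lab y)) (cong level (sym ex)) y↑
      by-type (down-W x↑ ey) =
        split-as (share-> (lab x) (lab y) y<x) (trans (downward-W xy ey) (cong 𝟙 (Above⇒∈Vi+1 x↑)))
                 (sameLevel-level (<⇒≢ y<x)) refl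
        where y<x = subst (_< level (lab x)) (cong level (sym ey)) x↑
      by-type (top-top ex ey) =
        split-as (share-tie ex ey refl) (flat ex ey refl) (at ex) refl

  ∑-weight : ∀ x → ∑[ y < n ] weight x y ≡ base (lab x) + 6 * level (lab x)
  ∑-weight x = begin
    ∑[ y < n ] weight x y
      ≡⟨ sum-cong-≗ (weight-split x) ⟩
    ∑[ y < n ] (2 * downward x y + sameLevel x (lab x) y)
      ≡⟨ ∑-distrib-+ (λ y → 2 * downward x y) _ ⟩
    ∑[ y < n ] (2 * downward x y) + ∑[ y < n ] sameLevel x (lab x) y
      ≡⟨ cong₂ _+_ (sym (*-distribˡ-sum 2 (downward x))) (∑-sameLevel x) ⟩
    2 * ∑[ y < n ] downward x y + base (lab x)
      ≡⟨ cong (λ k → 2 * k + base (lab x)) (∑-downward x) ⟩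
    2 * (3 * level (lab x)) + base (lab x)
      ≡⟨ +-comm _ (base (lab x)) ⟩
    base (lab x) + 2 * (3 * level (lab x))
      ≡⟨ cong (base (lab x) +_) (*-assoc 2 3 (level (lab x))) ⟨
    base (lab x) + 6 * level (lab x)                                    ∎
    where open ≡-Reasoning

  ∑-level : ∑[ x < n ] level (lab x) ≡ sumLevels F
  ∑-level = sym (begin
    sumLevels F                                ≡⟨ ∑-allFin (λ i → card (Vi+1 i)) ⟩
    ∑[ i < r ] card (Vi+1 i)                   ≡⟨ sum-cong-≗ (λ i → card≡∑ (Vi+1 i)) ⟩
    ∑[ i < r ] ∑[ x < n ] 𝟙 (Vi+1 i x)         ≡⟨ ∑-comm (λ i x → 𝟙 (Vi+1 i x)) ⟩
    ∑[ x < n ] ∑[ i < r ] 𝟙 (Vi+1 i x)         ≡⟨ sum-cong-≗ levels-above ⟩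
    ∑[ x < n ] level (lab x)                   ∎)
    where
    open ≡-Reasoning
    levels-above : ∀ x → ∑[ i < r ] 𝟙 (Vi+1 i x) ≡ level (lab x)
    levels-above x = trans (sum-cong-≗ (λ i → cong 𝟙 (inLevel-level i (lab x)))) (∑-𝟙-<ᵇ _ (level≤r (lab x)))

  rootCount : Fin n → ℕ
  rootCount x = ∑[ i < r ] ∑[ j < 3 ] 𝟙 (x == v i j)

  ∑-rootCount : ∑[ x < n ] rootCount x ≡ r * 3
  ∑-rootCount = begin
    ∑[ x < n ] ∑[ i < r ] ∑[ j < 3 ] 𝟙 (x == v i j)
      ≡⟨ ∑-comm (λ x i → ∑[ j < 3 ] 𝟙 (x == v i j)) ⟩
    ∑[ i < r ] ∑[ x < n ] ∑[ j < 3 ] 𝟙 (x == v i j)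
      ≡⟨ sum-cong-≗ (λ i → ∑-comm (λ x j → 𝟙 (x == v i j))) ⟩
    ∑[ i < r ] ∑[ j < 3 ] ∑[ x < n ] 𝟙 (x == v i j)
      ≡⟨ sum-cong-≗ (λ i → sum-cong-≗ (λ j → ∑-point (v i j))) ⟩
    ∑[ i < r ] 3
      ≡⟨ ∑-const r 3 ⟩
    r * 3                                              ∎
    where open ≡-Reasoning

  -- A root collects one less than a petal vertex: this is the −r of the formula.
  base+rootCount : ∀ x → base (lab x) + rootCount x ≡ 3 * 𝟙 (not (Vtop x))
  base+rootCount x = go (lab x) refl
    where
    no-root : (∀ i j → lab x ≢ root i j) → rootCount x ≡ 0
    no-root ¬root = ∑-zero _ λ i → ∑-zero _ λ j → not-root (¬root i j)
    go : ∀ l → lab x ≡ l → base l + rootCount x ≡ 3 * 𝟙 (not (isTop l))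
    go top        e = no-root λ _ _ e′ → label-clash e e′ λ ()
    go (inW _ _)  e = cong (3 +_) (no-root λ _ _ e′ → label-clash e e′ λ ())
    go (inU _ _)  e = cong (3 +_) (no-root λ _ _ e′ → label-clash e e′ λ ())
    go (inY _ _)  e = cong (3 +_) (no-root λ _ _ e′ → label-clash e e′ λ ())
    go (root i₀ j₀) e rewrite v-uniq x i₀ j₀ e = cong (2 +_) (trans (∑-unique _ i₀ other-layer) own-layer)
      where
      other-layer : ∀ i → i ≢ i₀ → ∑[ j < 3 ] 𝟙 (v i₀ j₀ == v i j) ≡ 0
      other-layer i i≢i₀ = ∑-zero (λ j → 𝟙 (v i₀ j₀ == v i j)) λ j → not-root λ e′ →
        i≢i₀ (proj₁ (root-injective (trans (sym e′) (v-lab i₀ j₀))))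
      own-layer : ∑[ j < 3 ] 𝟙 (v i₀ j₀ == v i₀ j) ≡ 1
      own-layer = ∑-𝟙-unique _ j₀ (==-refl (v i₀ j₀)) λ j t → sym (v-injective (==-sound t))

  ∑-base : ∑[ x < n ] base (lab x) ≡ 3 * (n ∸ card Vtop ∸ r)
  ∑-base = sym (begin
    3 * (n ∸ card Vtop ∸ r)
      ≡⟨ cong (λ m → 3 * (m ∸ card Vtop ∸ r)) n≡ ⟩
    3 * (card Vtop + outside ∸ card Vtop ∸ r)
      ≡⟨ cong (λ m → 3 * (m ∸ r)) (m+n∸m≡n (card Vtop) outside) ⟩
    3 * (outside ∸ r)
      ≡⟨ *-distribˡ-∸ 3 outside r ⟩
    3 * outside ∸ 3 * r
      ≡⟨ cong₂ _∸_ (sym bases+roots) (*-comm 3 r) ⟩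
    ∑[ x < n ] base (lab x) + r * 3 ∸ r * 3
      ≡⟨ m+n∸n≡m _ (r * 3) ⟩
    ∑[ x < n ] base (lab x)                     ∎)
    where
    open ≡-Reasoning
    outside = ∑[ x < n ] 𝟙 (not (Vtop x))
    n≡ : n ≡ card Vtop + outside
    n≡ = begin
      n                                                  ≡⟨ *-identityʳ n ⟨
      n * 1                                              ≡⟨ ∑-const n 1 ⟨
      ∑[ x < n ] 1                                       ≡⟨ sum-cong-≗ (λ x → 𝟙-complement (Vtop x)) ⟨
      ∑[ x < n ] (𝟙 (Vtop x) + 𝟙 (not (Vtop x)))         ≡⟨ ∑-distrib-+ (λ x → 𝟙 (Vtop x)) _ ⟩
      ∑[ x < n ] 𝟙 (Vtop x) + outside                    ≡⟨ cong (_+ outside) (card≡∑ Vtop) ⟨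
      card Vtop + outside                                ∎
    bases+roots : ∑[ x < n ] base (lab x) + r * 3 ≡ 3 * outside
    bases+roots = begin
      ∑[ x < n ] base (lab x) + r * 3
        ≡⟨ cong (∑[ x < n ] base (lab x) +_) ∑-rootCount ⟨
      ∑[ x < n ] base (lab x) + ∑[ x < n ] rootCount x
        ≡⟨ ∑-distrib-+ (λ x → base (lab x)) rootCount ⟨
      ∑[ x < n ] (base (lab x) + rootCount x)
        ≡⟨ sum-cong-≗ base+rootCount ⟩
      ∑[ x < n ] (3 * 𝟙 (not (Vtop x)))
        ≡⟨ *-distribˡ-sum 3 (λ x → 𝟙 (not (Vtop x))) ⟨
      3 * outside                                        ∎

  edge-count : 2 * numEdges A ≡ 2 * numEdges (induced A Vtop) + 3 * (n ∸ card Vtop ∸ r) + 6 * sumLevels F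
  edge-count = begin
    2 * numEdges A
      ≡⟨ handshake A simpleA ⟩
    ∑[ x < n ] ∑[ y < n ] 𝟙 (A x y)
      ≡⟨ sum-cong-≗ (λ x → sum-cong-≗ (λ y → 𝟙-split (Vtop x) (Vtop y) (A x y))) ⟩
    ∑[ x < n ] ∑[ y < n ] (𝟙 (induced A Vtop x y) + 𝟙 (crossing x y))
      ≡⟨ sum-cong-≗ (λ x → ∑-distrib-+ (λ y → 𝟙 (induced A Vtop x y)) (λ y → 𝟙 (crossing x y))) ⟩
    ∑[ x < n ] (∑[ y < n ] 𝟙 (induced A Vtop x y) + ∑[ y < n ] 𝟙 (crossing x y))
      ≡⟨ ∑-distrib-+ (λ x → ∑[ y < n ] 𝟙 (induced A Vtop x y)) _ ⟩
    ∑[ x < n ] ∑[ y < n ] 𝟙 (induced A Vtop x y) + ∑[ x < n ] ∑[ y < n ] 𝟙 (crossing x y)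
      ≡⟨ cong₂ _+_ (sym (handshake (induced A Vtop) (induced-simple Vtop simpleA)))
    (∑∑-symmetrise weight _ weight-sum) ⟩
    2 * E₀ + ∑[ x < n ] ∑[ y < n ] weight x y
      ≡⟨ cong (2 * E₀ +_) (sum-cong-≗ ∑-weight) ⟩
    2 * E₀ + ∑[ x < n ] (base (lab x) + 6 * level (lab x))
      ≡⟨ cong (2 * E₀ +_) (∑-distrib-+ (λ x → base (lab x)) _) ⟩
    2 * E₀ + (∑[ x < n ] base (lab x) + ∑[ x < n ] (6 * level (lab x)))
      ≡⟨ cong₂ (λ a b → 2 * E₀ + (a + b)) ∑-base
    (trans (sym (*-distribˡ-sum 6 (λ x → level (lab x)))) (cong (6 *_) ∑-level)) ⟩
    2 * E₀ + (3 * (n ∸ card Vtop ∸ r) + 6 * sumLevels F)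
      ≡⟨ +-assoc (2 * E₀) _ _ ⟨
    2 * E₀ + 3 * (n ∸ card Vtop ∸ r) + 6 * sumLevels F                 ∎
    where
    open ≡-Reasoning
    E₀ = numEdges (induced A Vtop)
    crossing : Fin n → Fin n → Bool
    crossing x y = A x y ∧ not (Vtop x ∧ Vtop y)

least-of-four : ∀ p q s t → (p ≤ q × p ≤ s × p ≤ t) ⊎ (q ≤ s × q ≤ t × q ≤ p) ⊎
                            (s ≤ t × s ≤ p × s ≤ q) ⊎ (t ≤ p × t ≤ q × t ≤ s)
least-of-four p q s t with ≤-total p q | ≤-total s t
... | inj₁ p≤q | inj₁ s≤t with ≤-total p s
...   | inj₁ p≤s = inj₁ (p≤q , p≤s , ≤-trans p≤s s≤t)
...   | inj₂ s≤p = inj₂ (inj₂ (inj₁ (s≤t , s≤p , ≤-trans s≤p p≤q)))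
least-of-four p q s t | inj₁ p≤q | inj₂ t≤s with ≤-total p t
...   | inj₁ p≤t = inj₁ (p≤q , ≤-trans p≤t t≤s , p≤t)
...   | inj₂ t≤p = inj₂ (inj₂ (inj₂ (t≤p , ≤-trans t≤p p≤q , t≤s)))
least-of-four p q s t | inj₂ q≤p | inj₁ s≤t with ≤-total q s
...   | inj₁ q≤s = inj₂ (inj₁ (q≤s , ≤-trans q≤s s≤t , q≤p))
...   | inj₂ s≤q = inj₂ (inj₂ (inj₁ (s≤t , ≤-trans s≤q q≤p , s≤q)))
least-of-four p q s t | inj₂ q≤p | inj₂ t≤s with ≤-total q t
...   | inj₁ q≤t = inj₂ (inj₁ (≤-trans q≤t t≤s , q≤t , q≤p))
...   | inj₂ t≤q = inj₂ (inj₂ (inj₂ (≤-trans t≤q q≤p , t≤q , t≤s)))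

module C4Freeness {n r : ℕ} {Γ A : Graph n} (simpleA : IsSimple A) (F : Flower Γ A r) where

  open FlowerStructure simpleA F

  record Square (a b c d : Fin n) : Set where
    field
      a≢b : a ≢ b
      a≢c : a ≢ c
      a≢d : a ≢ d
      b≢c : b ≢ c
      b≢d : b ≢ d
      c≢d : c ≢ d
      ab  : Edge A a b
      bc  : Edge A b c
      cd  : Edge A c d
      da  : Edge A d a

  open Square

  rotate : ∀ {a b c d} → Square a b c d → Square b c d a
  rotate s = record
    { a≢b = b≢c s ; a≢c = b≢d s ; a≢d = ≢-sym (a≢b s)
    ; b≢c = c≢d s ; b≢d = ≢-sym (a≢c s) ; c≢d = ≢-sym (a≢d s)
    ; ab = bc s ; bc = cd s ; cd = da s ; da = ab s }

  reflect : ∀ {a b c d} → Square a b c d → Square a d c b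
  reflect s = record
    { a≢b = a≢d s ; a≢c = a≢c s ; a≢d = a≢b s
    ; b≢c = ≢-sym (c≢d s) ; b≢d = ≢-sym (b≢d s) ; c≢d = ≢-sym (b≢c s)
    ; ab = edge-sym (da s) ; bc = edge-sym (cd s) ; cd = edge-sym (bc s) ; da = edge-sym (ab s) }

  AtLeast : Fin r → Fin n → Set
  AtLeast m x = toℕ m ≤ level (lab x)

  ¬Above-level : ∀ {m x} → level (lab x) ≡ toℕ m → ¬ Above m (lab x)
  ¬Above-level e = <-irrefl (sym e)

  same-root : ∀ {x y i j} → lab x ≡ root i j → lab y ≡ root i j → x ≡ y
  same-root {x} {y} {i} {j} x-root y-root = trans (v-uniq x i j x-root) (sym (v-uniq y i j y-root))

  root-index : ∀ {x i j k} → lab x ≡ root i j → lab x ≡ root i k → j ≡ k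
  root-index x-root x-root′ = proj₂ (root-injective (trans (sym x-root) x-root′))

  no-climb : ∀ {b c i j m} → level (lab b) ≡ toℕ m → AtLeast m c → Above i (lab b) → lab c ≡ inW i j → ⊥
  no-climb {i = i} {m = m} b-level m≤c b↑ c-W =
    <⇒≱ (subst (toℕ i <_) b-level b↑) (subst (toℕ m ≤_) (cong level c-W) m≤c)

  below : ∀ {c d m} → level (lab c) ≡ toℕ m → Above m (lab d) → level (lab c) < level (lab d)
  below {d = d} c-level d↑ = subst (_< level (lab d)) (sym c-level) d↑

  root-neighbour : ∀ {b c m k} → lab b ≡ root m k → Edge A b c → AtLeast m c →
    (Σ (Fin 3) λ k′ → lab c ≡ root m k′ × k ≢ k′) ⊎ Petal m k (lab c)
  root-neighbour {b} {c} {m} {k} b-root bc m≤c = go (edgeType bc)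
    where
    go : EdgeType b c → (Σ (Fin 3) λ k′ → lab c ≡ root m k′ × k ≢ k′) ⊎ Petal m k (lab c)
    go (root-root e c-root k≢k′) with trans (sym b-root) e
    ... | refl = inj₁ (_ , c-root , k≢k′)
    go (root-petal e c-petal) with trans (sym b-root) e
    ... | refl = inj₂ c-petal
    go (petal-root p _)  = ⊥-elim (petal≢root p b-root)
    go (mates mt)        = ⊥-elim (petal≢root (mates⇒petal (mates-sym mt)) b-root)
    go (W-down e _)      = ⊥-elim (label-clash b-root e λ ())
    go (down-W b↑ c-W)   = ⊥-elim (no-climb (cong level b-root) m≤c b↑ c-W)
    go (top-top e _)     = ⊥-elim (label-clash b-root e λ ())

  petal-neighbour : ∀ {b c m j} → Petal m j (lab b) → Edge A b c → AtLeast m c →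
    lab c ≡ root m j ⊎ Mates m j (lab b) (lab c) ⊎ (lab b ≡ inW m j × Above m (lab c))
  petal-neighbour {b} {c} {m} {j} b-petal bc m≤c = go (edgeType bc)
    where
    go : EdgeType b c → lab c ≡ root m j ⊎ Mates m j (lab b) (lab c) ⊎ (lab b ≡ inW m j × Above m (lab c))
    go (root-root e _ _)  = ⊥-elim (petal≢root b-petal e)
    go (root-petal e _)   = ⊥-elim (petal≢root b-petal e)
    go (petal-root p c-root) with petal-unique b-petal p
    ... | refl , refl = inj₁ c-root
    go (mates mt) with petal-unique b-petal (mates⇒petal (mates-sym mt))
    ... | refl , refl = inj₂ (inj₁ mt)
    go (W-down e c↑) with petal-unique b-petal (W∈ e)
    ... | refl , refl = inj₂ (inj₂ (e , c↑))
    go (down-W b↑ c-W)    = ⊥-elim (no-climb (level-petal b-petal) m≤c b↑ c-W)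
    go (top-top e _)      = ⊥-elim (petal≢top b-petal e)

  downhill : ∀ {b c} → Edge A b c → level (lab c) < level (lab b) →
    Σ (Fin r) λ i → Σ (Fin 3) λ j → lab c ≡ inW i j × Above i (lab b)
  downhill {b} {c} bc c<b = go (edgeType bc)
    where
    flat : level (lab c) ≡ level (lab b) → Σ (Fin r) λ i → Σ (Fin 3) λ j → lab c ≡ inW i j × Above i (lab b)
    flat e = ⊥-elim (<-irrefl e c<b)
    go : EdgeType b c → Σ (Fin r) λ i → Σ (Fin 3) λ j → lab c ≡ inW i j × Above i (lab b)
    go (root-root b-root c-root _) = flat (trans (cong level c-root) (sym (cong level b-root)))
    go (root-petal b-root p)       = flat (trans (level-petal p) (sym (cong level b-root)))
    go (petal-root p c-root)       = flat (trans (cong level c-root) (sym (level-petal p)))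
    go (mates mt)                  = flat (trans (level-petal (mates⇒petal mt))
                                                 (sym (level-petal (mates⇒petal (mates-sym mt)))))
    go (W-down b-W c↑)             = ⊥-elim (<-asym c↑ (subst (level (lab c) <_) (cong level b-W) c<b))
    go (down-W b↑ c-W)             = _ , _ , c-W , b↑
    go (top-top b-top c-top)       = flat (trans (cong level c-top) (sym (cong level b-top)))

  roots-square : ∀ {a b c d m j k l} → Square a b c d → lab a ≡ root m j → lab b ≡ root m k → j ≢ k →
    lab d ≡ root m l → j ≢ l → AtLeast m c → ⊥
  roots-square {j = j} {k} {l} s a-root b-root j≢k d-root j≢l m≤c
    with root-neighbour b-root (bc s) m≤c | root-neighbour d-root (edge-sym (cd s)) m≤c
  ... | inj₁ (k′ , c-root , k≢k′) | inj₁ (_ , c-root′ , l≢l′) with root-index c-root c-root′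
  ...   | refl = no-fourth-in-Fin3 j≢k j≢l k≢l j≢k′ k≢k′ l≢l′
    where
    k≢l : k ≢ l
    k≢l refl = b≢d s (same-root b-root d-root)
    j≢k′ : j ≢ k′
    j≢k′ refl = a≢c s (same-root a-root c-root)
  roots-square s _ _ _ _ _ _ | inj₁ (_ , c-root , _) | inj₂ c-petal = petal≢root c-petal c-root
  roots-square s _ _ _ _ _ _ | inj₂ c-petal | inj₁ (_ , c-root , _) = petal≢root c-petal c-root
  roots-square s _ b-root _ d-root _ _ | inj₂ c-petal | inj₂ c-petal′ with petal-unique c-petal c-petal′
  ... | _ , refl = b≢d s (same-root b-root d-root)

  root-root-petal : ∀ {a b c d m j k} → Square a b c d → lab a ≡ root m j → lab b ≡ root m k → j ≢ k →
    Petal m j (lab d) → AtLeast m c → ⊥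
  root-root-petal s a-root b-root j≢k d-petal m≤c
    with root-neighbour b-root (bc s) m≤c | petal-neighbour d-petal (edge-sym (cd s)) m≤c
  ... | inj₁ (_ , c-root , _) | inj₁ c-root′           = a≢c s (same-root a-root c-root′)
  ... | inj₁ (_ , c-root , _) | inj₂ (inj₁ mt)         = petal≢root (mates⇒petal mt) c-root
  ... | inj₁ (_ , c-root , _) | inj₂ (inj₂ (_ , c↑))   = ¬Above-level (cong level c-root) c↑
  ... | inj₂ c-petal          | inj₁ c-root            = petal≢root c-petal c-root
  ... | inj₂ c-petal          | inj₂ (inj₁ mt)         = j≢k (sym (proj₂ (petal-unique c-petal (mates⇒petal mt))))
  ... | inj₂ c-petal          | inj₂ (inj₂ (_ , c↑))   = ¬Above-level (level-petal c-petal) c↑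

  root-petal-petal : ∀ {a b c d m j} → Square a b c d → lab a ≡ root m j → Petal m j (lab b) →
    Petal m j (lab d) → AtLeast m c → ⊥
  root-petal-petal s a-root b-petal d-petal m≤c
    with petal-neighbour b-petal (bc s) m≤c | petal-neighbour d-petal (edge-sym (cd s)) m≤c
  ... | inj₁ c-root              | _                       = a≢c s (same-root a-root c-root)
  ... | inj₂ _                   | inj₁ c-root             = a≢c s (same-root a-root c-root)
  ... | inj₂ (inj₁ mb)           | inj₂ (inj₁ md)          =
    b≢d s (mate-unique (mates-sym mb) (mates-sym md) (edge-sym (bc s)) (cd s))
  ... | inj₂ (inj₁ mb)           | inj₂ (inj₂ (_ , c↑))    = ¬Above-level (level-petal (mates⇒petal mb)) c↑
  ... | inj₂ (inj₂ (_ , c↑))     | inj₂ (inj₁ md)          = ¬Above-level (level-petal (mates⇒petal md)) c↑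
  ... | inj₂ (inj₂ (b-W , c↑))   | inj₂ (inj₂ (d-W , _))   =
    b≢d s (W-partner-unique c↑ b-W d-W (bc s) (edge-sym (cd s)))

  from-root : ∀ {a b c d m j} → Square a b c d → lab a ≡ root m j →
    AtLeast m b → AtLeast m c → AtLeast m d → ⊥
  from-root s a-root m≤b m≤c m≤d
    with root-neighbour a-root (ab s) m≤b | root-neighbour a-root (edge-sym (da s)) m≤d
  ... | inj₁ (_ , b-root , j≢k) | inj₁ (_ , d-root , j≢l) = roots-square s a-root b-root j≢k d-root j≢l m≤c
  ... | inj₁ (_ , b-root , j≢k) | inj₂ d-petal            = root-root-petal s a-root b-root j≢k d-petal m≤c
  ... | inj₂ b-petal            | inj₁ (_ , d-root , j≢l) = root-root-petal (reflect s) a-root d-root j≢l b-petal m≤c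
  ... | inj₂ b-petal            | inj₂ d-petal            = root-petal-petal s a-root b-petal d-petal m≤c

  petal-root-mate : ∀ {a b c d m j} → Square a b c d → lab b ≡ root m j → Mates m j (lab a) (lab d) →
    AtLeast m c → ⊥
  petal-root-mate s b-root md m≤c
    with root-neighbour b-root (bc s) m≤c | petal-neighbour (mates⇒petal md) (edge-sym (cd s)) m≤c
  ... | inj₁ (_ , c-root , j≢k′) | inj₁ c-root′          = j≢k′ (root-index c-root′ c-root)
  ... | inj₁ (_ , c-root , _)    | inj₂ (inj₁ mt)        = petal≢root (mates⇒petal mt) c-root
  ... | inj₁ (_ , c-root , _)    | inj₂ (inj₂ (_ , c↑))  = ¬Above-level (cong level c-root) c↑
  ... | inj₂ c-petal             | inj₁ c-root           = petal≢root c-petal c-root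
  ... | inj₂ c-petal             | inj₂ (inj₁ mdc)       = a≢c s (mate-unique (mates-sym md) mdc (da s) (edge-sym (cd s)))
  ... | inj₂ c-petal             | inj₂ (inj₂ (_ , c↑))  = ¬Above-level (level-petal c-petal) c↑

  petal-root-down : ∀ {a b c d m j} → Square a b c d → lab b ≡ root m j → lab a ≡ inW m j →
    Above m (lab d) → AtLeast m c → ⊥
  petal-root-down s b-root a-W d↑ m≤c with root-neighbour b-root (bc s) m≤c
  ... | inj₁ (_ , c-root , _) with downhill (edge-sym (cd s)) (below (cong level c-root) d↑)
  ...   | _ , _ , c-W , _ = label-clash c-root c-W λ ()
  petal-root-down s b-root a-W d↑ m≤c | inj₂ c-petal
    with downhill (edge-sym (cd s)) (below (level-petal c-petal) d↑)
  ...   | _ , _ , c-W , _ with petal-unique c-petal (W∈ c-W)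
  ...     | refl , refl = a≢c s (W-partner-unique d↑ a-W c-W (edge-sym (da s)) (cd s))

  petal-mate-down : ∀ {a b c d m j} → Square a b c d → Mates m j (lab a) (lab b) → lab a ≡ inW m j →
    Above m (lab d) → AtLeast m c → ⊥
  petal-mate-down s (U-W e _) a-W _ _ = label-clash e a-W λ ()
  petal-mate-down s (Y-Y e _) a-W _ _ = label-clash e a-W λ ()
  petal-mate-down s mb@(W-U _ b-U) a-W d↑ m≤c with petal-neighbour (U∈ b-U) (bc s) m≤c
  ... | inj₁ c-root with downhill (edge-sym (cd s)) (below (cong level c-root) d↑)
  ...   | _ , _ , c-W , _ = label-clash c-root c-W λ ()
  petal-mate-down s mb@(W-U _ b-U) a-W d↑ m≤c | inj₂ (inj₁ mbc) =
    a≢c s (mate-unique (mates-sym mb) mbc (edge-sym (ab s)) (bc s))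
  petal-mate-down s (W-U _ b-U) a-W d↑ m≤c | inj₂ (inj₂ (b-W , _)) = label-clash b-U b-W λ ()

  from-petal : ∀ {a b c d m j} → Square a b c d → Petal m j (lab a) →
    AtLeast m b → AtLeast m c → AtLeast m d → ⊥
  from-petal s a-petal m≤b m≤c m≤d
    with petal-neighbour a-petal (ab s) m≤b | petal-neighbour a-petal (edge-sym (da s)) m≤d
  ... | inj₁ b-root             | inj₁ d-root             = b≢d s (same-root b-root d-root)
  ... | inj₁ b-root             | inj₂ (inj₁ md)          = petal-root-mate s b-root md m≤c
  ... | inj₁ b-root             | inj₂ (inj₂ (a-W , d↑))  = petal-root-down s b-root a-W d↑ m≤c
  ... | inj₂ (inj₁ mb)          | inj₁ d-root             = petal-root-mate (reflect s) d-root mb m≤c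
  ... | inj₂ (inj₁ mb)          | inj₂ (inj₁ md)          = b≢d s (mate-unique mb md (ab s) (edge-sym (da s)))
  ... | inj₂ (inj₁ mb)          | inj₂ (inj₂ (a-W , d↑))  = petal-mate-down s mb a-W d↑ m≤c
  ... | inj₂ (inj₂ (a-W , b↑))  | inj₁ d-root             = petal-root-down (reflect s) d-root a-W b↑ m≤c
  ... | inj₂ (inj₂ (a-W , b↑))  | inj₂ (inj₁ md)          = petal-mate-down (reflect s) md a-W b↑ m≤c
  ... | inj₂ (inj₂ (a-W , b↑))  | inj₂ (inj₂ (_ , d↑))    =
    b≢d s (down-partner-unique a-W b↑ d↑ (ab s) (edge-sym (da s)))

  from-least : ∀ {a b c d} → Square a b c d → level (lab a) ≤ level (lab b) →
    level (lab a) ≤ level (lab c) → level (lab a) ≤ level (lab d) → ⊥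
  from-least {a} {b} {c} {d} s a≤b a≤c a≤d = go (lab a) refl
    where
    at : ∀ {l x} → lab a ≡ l → level (lab a) ≤ level (lab x) → level l ≤ level (lab x)
    at {x = x} e = subst (_≤ level (lab x)) (cong level e)
    top-too : ∀ {x} → lab a ≡ top → level (lab a) ≤ level (lab x) → x ∈ Vtop
    top-too {x} a-top a≤x = lab⇒∈Vtop (level≡r⇒top (lab x) (≤-antisym (level≤r (lab x)) (at a-top a≤x)))
    go : ∀ l → lab a ≡ l → ⊥
    go top a-top = proj₁ (proj₂ cond5)
      (a , b , c , d , (a≢b s , a≢c s , a≢d s , b≢c s , b≢d s , c≢d s) ,
       (induced-edge⁺ A Vtop a∈ b∈ (ab s) , induced-edge⁺ A Vtop b∈ c∈ (bc s) ,
        induced-edge⁺ A Vtop c∈ d∈ (cd s) , induced-edge⁺ A Vtop d∈ a∈ (da s)))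
      where
      a∈ = lab⇒∈Vtop a-top
      b∈ = top-too a-top a≤b
      c∈ = top-too a-top a≤c
      d∈ = top-too a-top a≤d
    go (root m j) e = from-root s e (at e a≤b) (at e a≤c) (at e a≤d)
    go (inW m j)  e = from-petal s (W∈ e) (at e a≤b) (at e a≤c) (at e a≤d)
    go (inU m j)  e = from-petal s (U∈ e) (at e a≤b) (at e a≤c) (at e a≤d)
    go (inY m j)  e = from-petal s (Y∈ e) (at e a≤b) (at e a≤c) (at e a≤d)

  no-square : ∀ {a b c d} → Square a b c d → ⊥
  no-square {a} {b} {c} {d} s with least-of-four (level (lab a)) (level (lab b)) (level (lab c)) (level (lab d))
  ... | inj₁ (a≤b , a≤c , a≤d)               = from-least s a≤b a≤c a≤d
  ... | inj₂ (inj₁ (b≤c , b≤d , b≤a))        = from-least (rotate s) b≤c b≤d b≤a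
  ... | inj₂ (inj₂ (inj₁ (c≤d , c≤a , c≤b))) = from-least (rotate (rotate s)) c≤d c≤a c≤b
  ... | inj₂ (inj₂ (inj₂ (d≤a , d≤b , d≤c))) = from-least (rotate (rotate (rotate s))) d≤a d≤b d≤c

  C4-free : C4Free A
  C4-free (_ , _ , _ , _ , (a≢b , a≢c , a≢d , b≢c , b≢d , c≢d) , (ab , bc , cd , da)) = no-square record
    { a≢b = a≢b ; a≢c = a≢c ; a≢d = a≢d ; b≢c = b≢c ; b≢d = b≢d ; c≢d = c≢d
    ; ab = ab ; bc = bc ; cd = cd ; da = da }

module Saturation {n r : ℕ} {Γ A : Graph n} (simpleA : IsSimple A) (F : Flower Γ A r) where

  open FlowerStructure simpleA F

  reverse : ∀ {x y} → Path3 A y x → Path3 A x y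
  reverse (p , q , yp , pq , qx) = q , p , edge-sym qx , edge-sym pq , edge-sym yp

  same-level : ∀ {i y} → toℕ i ≤ level (lab y) → ¬ Above i (lab y) → level (lab y) ≡ toℕ i
  same-level i≤y ¬y↑ = ≤-antisym (≮⇒≥ ¬y↑) i≤y

  path-from-root : ∀ {i j x y} → lab x ≡ root i j → ¬ Edge A x y → x ≢ y → toℕ i ≤ level (lab y) → Path3 A x y
  path-from-root {i} {j} {x} {y} x-root ¬xy x≢y i≤y with toℕ i <? level (lab y)
  ... | yes y↑ with W-partner j y↑
  ...   | w , w-W , wy with mate-exists (W∈ w-W)
  ...     | p , wp-mates , wp = p , w , root→petal x-root (mates⇒petal wp-mates) , edge-sym wp , wy
  path-from-root {i} {j} {x} {y} x-root ¬xy x≢y i≤y | no ¬y↑ = go (lab y) refl (same-level i≤y ¬y↑)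
    where
    petal : ∀ {k} → Petal i k (lab y) → Path3 A x y
    petal {k} y-petal with k ≟ᶠ j
    ... | yes refl = ⊥-elim (¬xy (root→petal x-root y-petal))
    ... | no k≢j with mate-exists y-petal
    ...   | p , yp-mates , yp = v i k , p , root→root x-root (k≢j ∘ sym) ,
                                edge-sym (petal→root (mates⇒petal yp-mates)) , edge-sym yp
    go : ∀ l → lab y ≡ l → level l ≡ toℕ i → Path3 A x y
    go top         _ e = ⊥-elim (<-irrefl (sym e) (toℕ<n i))
    go (root i′ k) e i′≡i with toℕ-injective i′≡i
    ... | refl with j ≟ᶠ k
    ...   | yes refl = ⊥-elim (x≢y (trans (v-uniq x i j x-root) (sym (v-uniq y i j e))))
    ...   | no j≢k   = ⊥-elim (¬xy (subst (Edge A x) (sym (v-uniq y i k e)) (root→root x-root j≢k)))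
    go (inW i′ k) e i′≡i with toℕ-injective i′≡i
    ... | refl = petal (W∈ e)
    go (inU i′ k) e i′≡i with toℕ-injective i′≡i
    ... | refl = petal (U∈ e)
    go (inY i′ k) e i′≡i with toℕ-injective i′≡i
    ... | refl = petal (Y∈ e)

  path-from-petal : ∀ {i j x y} → Petal i j (lab x) → ¬ Edge A x y → toℕ i ≤ level (lab y) → Path3 A x y
  path-from-petal {i} {j} {x} {y} x-petal ¬xy i≤y with toℕ i <? level (lab y)
  ... | yes y↑ with W-partner j y↑
  ...   | w , w-W , wy = v i j , w , petal→root x-petal , edge-sym (petal→root (W∈ w-W)) , wy
  path-from-petal {i} {j} {x} {y} x-petal ¬xy i≤y | no ¬y↑ = go (lab y) refl (same-level i≤y ¬y↑)
    where
    petal : ∀ {k} → Petal i k (lab y) → Path3 A x y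
    petal {k} y-petal with k ≟ᶠ j | mate-exists x-petal
    ... | yes refl | p , xp-mates , xp =
      p , v i j , xp , petal→root (mates⇒petal xp-mates) , edge-sym (petal→root y-petal)
    ... | no k≢j   | _ =
      v i j , v i k , petal→root x-petal , cond2 i j k (k≢j ∘ sym) , edge-sym (petal→root y-petal)
    go : ∀ l → lab y ≡ l → level l ≡ toℕ i → Path3 A x y
    go top         _ e = ⊥-elim (<-irrefl (sym e) (toℕ<n i))
    go (root i′ k) e i′≡i with toℕ-injective i′≡i
    ... | refl with k ≟ᶠ j | mate-exists x-petal
    ...   | yes refl | _ = ⊥-elim (¬xy (subst (Edge A x) (sym (v-uniq y i j e)) (petal→root x-petal)))
    ...   | no k≢j   | p , xp-mates , xp =
      p , v i j , xp , petal→root (mates⇒petal xp-mates) ,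
      subst (Edge A (v i j)) (sym (v-uniq y i k e)) (cond2 i j k (k≢j ∘ sym))
    go (inW i′ k) e i′≡i with toℕ-injective i′≡i
    ... | refl = petal (W∈ e)
    go (inU i′ k) e i′≡i with toℕ-injective i′≡i
    ... | refl = petal (U∈ e)
    go (inY i′ k) e i′≡i with toℕ-injective i′≡i
    ... | refl = petal (Y∈ e)

  path-upward : ∀ {x y} → ¬ Edge A x y → x ≢ y → level (lab x) ≤ level (lab y) → ¬ (lab x ≡ top × lab y ≡ top) →
    Path3 A x y
  path-upward {x} {y} ¬xy x≢y x≤y not-top = go (lab x) refl
    where
    at : ∀ {l} → lab x ≡ l → level l ≤ level (lab y)
    at e = subst (_≤ level (lab y)) (cong level e) x≤y
    go : ∀ l → lab x ≡ l → Path3 A x y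
    go top        e = ⊥-elim (not-top (e , level≡r⇒top (lab y) (≤-antisym (level≤r (lab y)) (at e))))
    go (root i j) e = path-from-root e ¬xy x≢y (at e)
    go (inW i j)  e = path-from-petal (W∈ e) ¬xy (at e)
    go (inU i j)  e = path-from-petal (U∈ e) ¬xy (at e)
    go (inY i j)  e = path-from-petal (Y∈ e) ¬xy (at e)

  path-outside-top : ∀ {x y} → ¬ Edge A x y → x ≢ y → ¬ (lab x ≡ top × lab y ≡ top) → Path3 A x y
  path-outside-top {x} {y} ¬xy x≢y not-top with ≤-total (level (lab x)) (level (lab y))
  ... | inj₁ x≤y = path-upward ¬xy x≢y x≤y not-top
  ... | inj₂ y≤x =
    reverse (path-upward (¬xy ∘ edge-sym) (x≢y ∘ sym) y≤x λ (y-top , x-top) → not-top (x-top , y-top))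

  outside-top : ∀ {z} → Vtop z ≡ false → lab z ≢ top
  outside-top z↓ z-top = true≢false (trans (sym (lab⇒∈Vtop z-top)) z↓)

  saturating : IsSimple Γ → ∀ x y → Edge Γ x y → ¬ Edge A x y → HasC4 (addEdge A x y)
  saturating simpleΓ x y xy ¬xy with Vtop x in x↑ | Vtop y in y↑
  ... | true  | true  =
    HasC4-mono (addEdge-mono (induced-⊆ A Vtop))
      (maximal⇒saturating (induced-simple Vtop simpleΓ) (induced-simple Vtop simpleA) cond5
                          (induced-edge⁺ Γ Vtop x↑ y↑ xy) (¬xy ∘ induced-⊆ A Vtop x y))
  ... | false | _     = path3⇒C4 simpleA ¬xy (edge⇒≢ simpleΓ xy)
                          (path-outside-top ¬xy (edge⇒≢ simpleΓ xy) λ (x-top , _) → outside-top x↑ x-top)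
  ... | true  | false = path3⇒C4 simpleA ¬xy (edge⇒≢ simpleΓ xy)
                          (path-outside-top ¬xy (edge⇒≢ simpleΓ xy) λ (_ , y-top) → outside-top y↑ y-top)

lemma6 : (n r : ℕ) (Γ A : Graph n) → IsSimple Γ → IsSimple A → A ⊆G Γ →
    (F : Flower Γ A r) →
    C4Saturated Γ A ×
    (2 * numEdges A ≡
       2 * numEdges (induced A (Flower.Vtop F))
       + 3 * (n ∸ card (Flower.Vtop F) ∸ r)
       + 6 * sumLevels F)
lemma6 n r Γ A simpleΓ simpleA A⊆Γ F =
  (A⊆Γ , C4Freeness.C4-free simpleA F , Saturation.saturating simpleA F simpleΓ) , EdgeCount.edge-count simpleA F
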